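{- For every even integer $n \geq 1$, $$\sum_{\substack{T \text{ even triangular number}\\ 0\le T\le n}} p\!\left(\frac{n-T}{2}\right) = p(n/2)+p((n-6)/2)+p((n-10)/2)+p((n-28)/2)+p((n-36)/2)+p((n-66)/2)+p((n-78)/2)+\cdots = p_d(n).$$ For every odd integer $n \geq 1$, $$\sum_{\substack{T \text{ odd triangular number}\\ T\le n}} p\!\left(\frac{n-T}{2}\right) = p((n-1)/2)+p((n-3)/2)+p((n-15)/2)+p((n-21)/2)+p((n-45)/2)+p((n-55)/2)+\cdots = p_o(n).$$
   Context: $p(n)$ is the number of partitions of $n$ (with $p(0)=1$ and $p(m)=0$ for $m<0$); $p_d(n)$ is the number of partitions of $n$ into distinct parts; $p_o(n)$ is the number of partitions of $n$ into odd parts. Triangular numbers are $j(j+1)/2$ for integers $j\ge 0$. The even triangular numbers are $0,6,10,28,36,66,78,\dots$ and the odd triangular numbers are $1,3,15,21,45,55,\dots$; each is counted once in the sums. -}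

module Defs where

open import Data.Nat using (ℕ; zero; suc; _+_; _*_; _∸_; _≤ᵇ_; _/_; _%_)
open import Data.Nat.Properties using (_≟_)
open import Data.Bool using (Bool; true; false; _∧_; if_then_else_)
open import Data.List using (List; []; _∷_; _++_; map; concatMap; replicate; length; filterᵇ; upTo)
open import Data.Nat.ListAction using (sum)
open import Relation.Nullary.Decidable using (does)

-- A partition is represented as a non-increasing list of positive parts.
-- partitionsBounded k n : all partitions of n whose parts are all ≤ k,
-- generated by choosing the multiplicity m of the part k, then recursing.
partitionsBounded : ℕ → ℕ → List (List ℕ)
partitionsBounded zero zero = [] ∷ []
partitionsBounded zero (suc n) = []
partitionsBounded (suc k) n =
  concatMap (λ m → map (replicate m (suc k) ++_)
                       (partitionsBounded k (n ∸ m * suc k)))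
            (filterᵇ (λ m → m * suc k ≤ᵇ n) (upTo (suc n)))

partitions : ℕ → List (List ℕ)
partitions n = partitionsBounded n n

p : ℕ → ℕ
p n = length (partitions n)

notIn : ℕ → List ℕ → Bool
notIn x [] = true
notIn x (y ∷ ys) = if does (x ≟ y) then false else notIn x ys

distinctParts : List ℕ → Bool
distinctParts [] = true
distinctParts (x ∷ xs) = notIn x xs ∧ distinctParts xs

isOdd : ℕ → Bool
isOdd n = does (n % 2 ≟ 1)

pd : ℕ → ℕ
pd n = length (filterᵇ distinctParts (partitions n))

allOdd : List ℕ → Bool
allOdd [] = true
allOdd (x ∷ xs) = isOdd x ∧ allOdd xs

po : ℕ → ℕ
po n = length (filterᵇ allOdd (partitions n))

sameBool : Bool → Bool → Bool
sameBool true true = true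
sameBool false false = true
sameBool _ _ = false

tri : ℕ → ℕ
tri j = (j * suc j) / 2

-- Since tri is strictly increasing for j ≥ 0 and tri j ≥ j,
-- ranging over j ∈ {0,…,n} lists every triangular number ≤ n exactly once.
triSum : Bool → ℕ → ℕ
triSum b n = sum (map (λ j → if (tri j ≤ᵇ n) ∧ sameBool (isOdd (tri j)) b
                              then p ((n ∸ tri j) / 2) else 0)
                      (upTo (suc n)))

-- The proof is by generating functions.  Write P = Σ p(n)qⁿ, D = Π (1 + qᵏ), O = Π_{k odd} 1/(1 − qᵏ),
-- P² = P(q²) and ψ = Σ_j q^(j(j+1)/2).  Infinite products are never formed: every identity
-- is first proved for the partition counts with parts ≤ k, which are characterised by
-- functional equations, and then transported to the limit, which they agree with up to
-- degree k.
module Submission where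

open import Defs
open import Data.Nat using (ℕ; zero; suc; _+_; _*_; _∸_; _≤_; _<_; z≤n; s≤s; _≤?_; _≤ᵇ_; _%_; _/_)
open import Data.Nat.Properties
open import Data.Nat.DivMod using (m*n/n≡m; [m+n]%n≡m%n)
open import Data.Nat.Divisibility using (_∣_; divides)
open import Data.Nat.Tactic.RingSolver using (solve-∀)
open import Data.Bool using (Bool; true; false; if_then_else_; _∧_; not; _xor_)
open import Data.Bool.Properties using (not-distribˡ-xor; xor-same)
open import Data.List using (List; []; _∷_; _++_; map; concatMap; replicate; length; filterᵇ; upTo; applyUpTo)
open import Data.Nat.ListAction using (sum)
open import Data.List.Relation.Unary.All as All using (All; []; _∷_)
import Data.List.Relation.Unary.All.Properties as AllP
open import Data.Product using (_×_; _,_; ∃)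
open import Data.Sum using (_⊎_; inj₁; inj₂)
open import Data.Empty using (⊥-elim)
open import Function using (case_of_)
open import Relation.Binary.PropositionalEquality
open import Relation.Nullary using (yes; no; ¬_; does)
open import Relation.Nullary.Decidable using (dec-true; dec-false)
open import Algebra.Bundles using (CommutativeSemiring)
open import Algebra.Properties.CommutativeSemigroup +-commutativeSemigroup using (interchange)
open import Relation.Binary.Structures using (IsEquivalence)
open import Relation.Binary.Bundles using (Setoid)
import Relation.Binary.Reasoning.Setoid

Series : Set
Series = ℕ → ℕ

infix 4 _≈_
_≈_ : Series → Series → Set
f ≈ g = ∀ n → f n ≡ g n

infixl 6 _⊕_
_⊕_ : Series → Series → Series
(f ⊕ g) n = f n + g n

𝟘 : Series
𝟘 _ = 0

δ : Series
δ zero = 1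
δ (suc n) = 0

tail : Series → Series
tail f i = f (suc i)

shift1 : Series → Series
shift1 f zero = 0
shift1 f (suc n) = f n

scale : ℕ → Series → Series
scale c f n = c * f n

-- The Cauchy product, by recursion on the degree: f·g = f₀·g + q·(tail f · g).
infixl 7 _⊛_
_⊛_ : Series → Series → Series
(f ⊛ g) zero = f 0 * g 0
(f ⊛ g) (suc n) = f 0 * g (suc n) + (tail f ⊛ g) n

_≈[_]_ : Series → ℕ → Series → Set
f ≈[ n ] g = ∀ i → i ≤ n → f i ≡ g i

-- The n-th coefficient of a product only depends on the factors up to degree n.  This is
-- what lets identities between truncated series pass to their limits.
⊛-cong-upto : ∀ n {f f′ g g′} → f ≈[ n ] f′ → g ≈[ n ] g′ → (f ⊛ g) n ≡ (f′ ⊛ g′) n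
⊛-cong-upto zero ff gg = cong₂ _*_ (ff 0 z≤n) (gg 0 z≤n)
⊛-cong-upto (suc n) ff gg =
  cong₂ _+_ (cong₂ _*_ (ff 0 z≤n) (gg (suc n) ≤-refl))
            (⊛-cong-upto n (λ i i≤n → ff (suc i) (s≤s i≤n)) (λ i i≤n → gg i (m≤n⇒m≤1+n i≤n)))

⊛-cong : ∀ {f f′ g g′} → f ≈ f′ → g ≈ g′ → f ⊛ g ≈ f′ ⊛ g′
⊛-cong ff gg n = ⊛-cong-upto n (λ i _ → ff i) (λ i _ → gg i)

⊕-cong : ∀ {f f′ g g′} → f ≈ f′ → g ≈ g′ → f ⊕ g ≈ f′ ⊕ g′
⊕-cong p q n = cong₂ _+_ (p n) (q n)

⊛-zeroˡ : ∀ g → 𝟘 ⊛ g ≈ 𝟘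
⊛-zeroˡ g zero = refl
⊛-zeroˡ g (suc n) = ⊛-zeroˡ g n

⊛-distribʳ : ∀ f g h → (f ⊕ g) ⊛ h ≈ f ⊛ h ⊕ g ⊛ h
⊛-distribʳ f g h zero = *-distribʳ-+ (h 0) (f 0) (g 0)
⊛-distribʳ f g h (suc n) =
  trans (cong₂ _+_ (*-distribʳ-+ (h (suc n)) (f 0) (g 0)) (⊛-distribʳ (tail f) (tail g) h n))
        (interchange (f 0 * h (suc n)) (g 0 * h (suc n)) ((tail f ⊛ h) n) ((tail g ⊛ h) n))

⊛-distribˡ : ∀ f g h → f ⊛ (g ⊕ h) ≈ f ⊛ g ⊕ f ⊛ h
⊛-distribˡ f g h zero = *-distribˡ-+ (f 0) (g 0) (h 0)
⊛-distribˡ f g h (suc n) =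
  trans (cong₂ _+_ (*-distribˡ-+ (f 0) (g (suc n)) (h (suc n))) (⊛-distribˡ (tail f) g h n))
        (interchange (f 0 * g (suc n)) (f 0 * h (suc n)) ((tail f ⊛ g) n) ((tail f ⊛ h) n))

⊛-scaleˡ : ∀ c f g → scale c f ⊛ g ≈ scale c (f ⊛ g)
⊛-scaleˡ c f g zero = *-assoc c (f 0) (g 0)
⊛-scaleˡ c f g (suc n) =
  trans (cong₂ _+_ (*-assoc c (f 0) (g (suc n))) (⊛-scaleˡ c (tail f) g n)) (sym (*-distribˡ-+ c _ _))

⊛-shift1ˡ : ∀ f g → shift1 f ⊛ g ≈ shift1 (f ⊛ g)
⊛-shift1ˡ f g zero = refl
⊛-shift1ˡ f g (suc n) = refl

⊛-identityˡ : ∀ g → δ ⊛ g ≈ g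
⊛-identityˡ g zero = +-identityʳ (g 0)
⊛-identityˡ g (suc n) = trans (cong₂ _+_ (+-identityʳ (g (suc n))) (⊛-zeroˡ g n)) (+-identityʳ _)

⊛-identityʳ : ∀ f → f ⊛ δ ≈ f
⊛-identityʳ f zero = *-identityʳ (f 0)
⊛-identityʳ f (suc n) = trans (cong (_+ (tail f ⊛ δ) n) (*-zeroʳ (f 0))) (⊛-identityʳ (tail f) n)

split-head : ∀ f → f ≈ scale (f 0) δ ⊕ shift1 (tail f)
split-head f zero = sym (trans (+-identityʳ _) (*-identityʳ _))
split-head f (suc n) = sym (cong (_+ f (suc n)) (*-zeroʳ (f 0)))

⊛-split-headˡ : ∀ f g → f ⊛ g ≈ scale (f 0) g ⊕ shift1 (tail f ⊛ g)
⊛-split-headˡ f g zero = sym (+-identityʳ _)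
⊛-split-headˡ f g (suc n) = refl

⊛-assoc : ∀ f g h → (f ⊛ g) ⊛ h ≈ f ⊛ (g ⊛ h)
⊛-assoc f g h zero = *-assoc (f 0) (g 0) (h 0)
⊛-assoc f g h (suc n) = begin
    ((f ⊛ g) ⊛ h) (suc n)
  ≡⟨ ⊛-cong (⊛-split-headˡ f g) (λ _ → refl) (suc n) ⟩
    ((scale (f 0) g ⊕ shift1 (tail f ⊛ g)) ⊛ h) (suc n)
  ≡⟨ ⊛-distribʳ (scale (f 0) g) (shift1 (tail f ⊛ g)) h (suc n) ⟩
    (scale (f 0) g ⊛ h) (suc n) + (shift1 (tail f ⊛ g) ⊛ h) (suc n)
  ≡⟨ cong₂ _+_ (⊛-scaleˡ (f 0) g h (suc n)) (⊛-assoc (tail f) g h n) ⟩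
    f 0 * (g ⊛ h) (suc n) + (tail f ⊛ (g ⊛ h)) n
  ∎ where open ≡-Reasoning

⊛-suc-symmetric : ∀ f g n → (tail f ⊛ g) n ≡ (g ⊛ tail f) n →
  (f ⊛ g) (suc n) ≡ f 0 * g (suc n) + (g 0 * f (suc n) + shift1 (tail g ⊛ tail f) n)
⊛-suc-symmetric f g n ih = cong (f 0 * g (suc n) +_) (begin
    (tail f ⊛ g) n
  ≡⟨ ih ⟩
    (g ⊛ tail f) n
  ≡⟨ ⊛-cong (split-head g) (λ _ → refl) n ⟩
    ((scale (g 0) δ ⊕ shift1 (tail g)) ⊛ tail f) n
  ≡⟨ ⊛-distribʳ (scale (g 0) δ) (shift1 (tail g)) (tail f) n ⟩
    (scale (g 0) δ ⊛ tail f) n + (shift1 (tail g) ⊛ tail f) n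
  ≡⟨ cong₂ _+_ (trans (⊛-scaleˡ (g 0) δ (tail f) n) (cong (g 0 *_) (⊛-identityˡ (tail f) n)))
               (⊛-shift1ˡ (tail g) (tail f) n) ⟩
    g 0 * f (suc n) + shift1 (tail g ⊛ tail f) n
  ∎) where open ≡-Reasoning

⊛-comm : ∀ f g → f ⊛ g ≈ g ⊛ f
⊛-comm f g zero = *-comm (f 0) (g 0)
⊛-comm f g (suc n) = begin
    (f ⊛ g) (suc n)
  ≡⟨ ⊛-suc-symmetric f g n (⊛-comm (tail f) g n) ⟩
    a + (b + shift1 (tail g ⊛ tail f) n)
  ≡⟨ cong (λ x → a + (b + x)) (shift1-comm n) ⟩
    a + (b + shift1 (tail f ⊛ tail g) n)
  ≡⟨ x+[y+z]≡y+[x+z] a b _ ⟩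
    b + (a + shift1 (tail f ⊛ tail g) n)
  ≡⟨ sym (⊛-suc-symmetric g f n (⊛-comm (tail g) f n)) ⟩
    (g ⊛ f) (suc n)
  ∎ where
  open ≡-Reasoning
  a = f 0 * g (suc n)
  b = g 0 * f (suc n)
  shift1-comm : ∀ m → shift1 (tail g ⊛ tail f) m ≡ shift1 (tail f ⊛ tail g) m
  shift1-comm zero = refl
  shift1-comm (suc m) = ⊛-comm (tail g) (tail f) m
  x+[y+z]≡y+[x+z] : ∀ x y z → x + (y + z) ≡ y + (x + z)
  x+[y+z]≡y+[x+z] = solve-∀

≈-isEquivalence : IsEquivalence _≈_
≈-isEquivalence = record
  { refl = λ n → refl ; sym = λ p n → sym (p n) ; trans = λ p q n → trans (p n) (q n) }

open IsEquivalence ≈-isEquivalence using () renaming (refl to ≈refl; sym to ≈sym; trans to ≈trans)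

≈-setoid : Setoid _ _
≈-setoid = record { isEquivalence = ≈-isEquivalence }

module ≈-Reasoning = Relation.Binary.Reasoning.Setoid ≈-setoid

open import Algebra.Structures {A = Series} _≈_ using (IsCommutativeMonoid)
import Algebra.Structures.Biased {A = Series} _≈_ as Biased

⊕-isCommutativeMonoid : IsCommutativeMonoid _⊕_ 𝟘
⊕-isCommutativeMonoid = record
  { isMonoid = record
    { isSemigroup = record
      { isMagma = record { isEquivalence = ≈-isEquivalence ; ∙-cong = ⊕-cong }
      ; assoc = λ f g h n → +-assoc (f n) (g n) (h n) }
    ; identity = (λ f n → refl) , (λ f n → +-identityʳ (f n)) }
  ; comm = λ f g n → +-comm (f n) (g n) }

⊛-isCommutativeMonoid : IsCommutativeMonoid _⊛_ δ
⊛-isCommutativeMonoid = record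
  { isMonoid = record
    { isSemigroup = record
      { isMagma = record { isEquivalence = ≈-isEquivalence ; ∙-cong = ⊛-cong }
      ; assoc = ⊛-assoc }
    ; identity = ⊛-identityˡ , ⊛-identityʳ }
  ; comm = ⊛-comm }

seriesSemiring : CommutativeSemiring _ _
seriesSemiring = record
  { Carrier = Series ; _≈_ = _≈_ ; _+_ = _⊕_ ; _*_ = _⊛_ ; 0# = 𝟘 ; 1# = δ
  ; isCommutativeSemiring = Biased.IsCommutativeSemiringˡ.isCommutativeSemiring (record
      { +-isCommutativeMonoid = ⊕-isCommutativeMonoid
      ; *-isCommutativeMonoid = ⊛-isCommutativeMonoid
      ; distribʳ = λ h f g → ⊛-distribʳ f g h
      ; zeroˡ = ⊛-zeroˡ }) }

open import Algebra.Solver.Ring.NaturalCoefficients.Default seriesSemiring using (solve; _:+_; _:*_; _:=_)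

⊛-zeroʳ : ∀ f → f ⊛ 𝟘 ≈ 𝟘
⊛-zeroʳ f = ≈trans (⊛-comm f 𝟘) (⊛-zeroˡ f)

shift : ℕ → Series → Series
shift zero f = f
shift (suc c) f = shift1 (shift c f)

X : ℕ → Series
X c = shift c δ

shift1-cong : ∀ {f g} → f ≈ g → shift1 f ≈ shift1 g
shift1-cong p zero = refl
shift1-cong p (suc n) = p n

shift-cong : ∀ c {f g} → f ≈ g → shift c f ≈ shift c g
shift-cong zero p = p
shift-cong (suc c) p = shift1-cong (shift-cong c p)

shift-⊛ : ∀ c f g → shift c f ⊛ g ≈ shift c (f ⊛ g)
shift-⊛ zero f g = ≈refl
shift-⊛ (suc c) f g = ≈trans (⊛-shift1ˡ (shift c f) g) (shift1-cong (shift-⊛ c f g))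

-- Shifting is multiplication by a monomial; this turns shifts into ring expressions.
shift-X : ∀ c f → shift c f ≈ X c ⊛ f
shift-X c f = ≈trans (shift-cong c (≈sym (⊛-identityˡ f))) (≈sym (shift-⊛ c δ f))

shift-+ : ∀ a b f → shift (a + b) f ≈ shift a (shift b f)
shift-+ zero b f = ≈refl
shift-+ (suc a) b f = shift1-cong (shift-+ a b f)

X-+ : ∀ a b → X (a + b) ≈ X a ⊛ X b
X-+ a b = ≈trans (shift-+ a b δ) (shift-X a (X b))

X-cong : ∀ {a b} → a ≡ b → X a ≈ X b
X-cong refl = ≈refl

X-interchange : ∀ a b c d → a + b ≡ c + d → X a ⊛ X b ≈ X c ⊛ X d
X-interchange a b c d eq = ≈trans (≈sym (X-+ a b)) (≈trans (X-cong eq) (X-+ c d))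

shift-≥ : ∀ c f r → shift c f (c + r) ≡ f r
shift-≥ zero f r = refl
shift-≥ (suc c) f r = shift-≥ c f r

shift-< : ∀ c f n → n < c → shift c f n ≡ 0
shift-< (suc c) f zero _ = refl
shift-< (suc c) f (suc n) (s≤s n<c) = shift-< c f n n<c

shift-upto : ∀ c n {f g} → f ≈[ n ] g → shift c f ≈[ n ] shift c g
shift-upto zero n p = p
shift-upto (suc c) n p zero _ = refl
shift-upto (suc c) (suc n) p (suc i) (s≤s i≤n) =
  shift-upto c n (λ j j≤n → p j (m≤n⇒m≤1+n j≤n)) i i≤n

shift-upto-suc : ∀ s r {f g} → f ≈[ r ] g → shift (suc s) f ≈[ suc r ] shift (suc s) g
shift-upto-suc s r p zero _ = refl
shift-upto-suc s r p (suc w) (s≤s w≤r) = shift-upto s r p w w≤r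

⊕-shift-low : ∀ k f g n → n ≤ k → (f ⊕ shift (suc k) g) n ≡ f n
⊕-shift-low k f g n n≤k = trans (cong (f n +_) (shift-< (suc k) g n (s≤s n≤k))) (+-identityʳ _)

shift-agree : ∀ c f g w → (c ≤ w → f (w ∸ c) ≡ g (w ∸ c)) → shift c f w ≡ shift c g w
shift-agree c f g w h with c ≤? w
... | yes c≤w = begin
    shift c f w             ≡⟨ cong (shift c f) (sym (m+[n∸m]≡n c≤w)) ⟩
    shift c f (c + (w ∸ c)) ≡⟨ shift-≥ c f (w ∸ c) ⟩
    f (w ∸ c)               ≡⟨ h c≤w ⟩
    g (w ∸ c)               ≡⟨ sym (shift-≥ c g (w ∸ c)) ⟩
    shift c g (c + (w ∸ c)) ≡⟨ cong (shift c g) (m+[n∸m]≡n c≤w) ⟩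
    shift c g w             ∎ where open ≡-Reasoning
... | no c≰w = trans (shift-< c f w (≰⇒> c≰w)) (sym (shift-< c g w (≰⇒> c≰w)))

X-cancel : ∀ c {f g} → X c ⊛ f ≈ X c ⊛ g → f ≈ g
X-cancel c {f} {g} p r = begin
    f r                   ≡⟨ sym (shift-≥ c f r) ⟩
    shift c f (c + r)     ≡⟨ shift-X c f (c + r) ⟩
    (X c ⊛ f) (c + r)     ≡⟨ p (c + r) ⟩
    (X c ⊛ g) (c + r)     ≡⟨ sym (shift-X c g (c + r)) ⟩
    shift c g (c + r)     ≡⟨ shift-≥ c g r ⟩
    g r                   ∎ where open ≡-Reasoning

upto-all : ∀ {f g} → (∀ n → f ≈[ n ] g) → f ≈ g
upto-all p n = p n n ≤-refl

upto-suc : ∀ {f g} n → f ≈[ n ] g → f (suc n) ≡ g (suc n) → f ≈[ suc n ] g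
upto-suc n p q i i≤1+n with m≤n⇒m<n∨m≡n i≤1+n
... | inj₁ (s≤s i≤n) = p i i≤n
... | inj₂ refl = q

-- A series with constant term 1 can be cancelled: its coefficients can be solved for
-- degree by degree.
cancel : ∀ {H A B} → H 0 ≡ 1 → H ⊛ A ≈ H ⊛ B → A ≈ B
cancel {H} {A} {B} h0 p = upto-all agree
  where
  one* : ∀ x → H 0 * x ≡ x
  one* x = trans (cong (_* x) h0) (+-identityʳ x)
  agree : ∀ n → A ≈[ n ] B
  agree zero zero _ = trans (sym (one* (A 0))) (trans (p 0) (one* (B 0)))
  agree (suc n) = upto-suc n (agree n) (begin
      A (suc n)                               ≡⟨ sym (one* _) ⟩
      H 0 * A (suc n)                         ≡⟨ +-cancelʳ-≡ _ _ _ top ⟩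
      H 0 * B (suc n)                         ≡⟨ one* _ ⟩
      B (suc n)                               ∎)
    where
    open ≡-Reasoning
    top : H 0 * A (suc n) + (tail H ⊛ A) n ≡ H 0 * B (suc n) + (tail H ⊛ A) n
    top = trans (p (suc n)) (cong (H 0 * B (suc n) +_) (sym (⊛-cong-upto n (λ _ _ → refl) (agree n))))

-- The equation F = A + q^(k+1)·F has at most one solution: it determines every
-- coefficient of F from lower ones.
unique-fixpoint : ∀ k {A F G} → F ≈ A ⊕ shift (suc k) F → G ≈ A ⊕ shift (suc k) G → F ≈ G
unique-fixpoint k {A} {F} {G} pF pG = upto-all agree
  where
  agree : ∀ n → F ≈[ n ] G
  agree zero zero _ = trans (pF 0) (sym (pG 0))
  agree (suc n) = upto-suc n (agree n)
    (trans (pF (suc n)) (trans (cong (A (suc n) +_) (shift-upto k n (agree n) n ≤-refl)) (sym (pG (suc n)))))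

sumN : ℕ → (ℕ → ℕ) → ℕ
sumN zero f = 0
sumN (suc L) f = f 0 + sumN L (λ i → f (suc i))

sumN-cong : ∀ L {f g} → (∀ i → i < L → f i ≡ g i) → sumN L f ≡ sumN L g
sumN-cong zero p = refl
sumN-cong (suc L) p = cong₂ _+_ (p 0 (s≤s z≤n)) (sumN-cong L (λ i i<L → p (suc i) (s≤s i<L)))

sumN-+ : ∀ L f g → sumN L (λ i → f i + g i) ≡ sumN L f + sumN L g
sumN-+ zero f g = refl
sumN-+ (suc L) f g = trans (cong (f 0 + g 0 +_) (sumN-+ L (λ i → f (suc i)) (λ i → g (suc i))))
                           (interchange (f 0) (g 0) _ _)

sumN-snoc : ∀ L f → sumN (suc L) f ≡ sumN L f + f L
sumN-snoc zero f = +-comm (f 0) 0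
sumN-snoc (suc L) f = trans (cong (f 0 +_) (sumN-snoc L (λ i → f (suc i)))) (sym (+-assoc (f 0) _ _))

sumN-split : ∀ a b f → sumN (a + b) f ≡ sumN a f + sumN b (λ i → f (a + i))
sumN-split zero b f = refl
sumN-split (suc a) b f = trans (cong (f 0 +_) (sumN-split a b (λ i → f (suc i)))) (sym (+-assoc (f 0) _ _))

sumN-zero : ∀ L f → (∀ i → i < L → f i ≡ 0) → sumN L f ≡ 0
sumN-zero zero f p = refl
sumN-zero (suc L) f p = cong₂ _+_ (p 0 (s≤s z≤n)) (sumN-zero L (λ i → f (suc i)) (λ i i<L → p (suc i) (s≤s i<L)))

sumN-extend : ∀ L L′ f → L ≤ L′ → (∀ i → L ≤ i → i < L′ → f i ≡ 0) → sumN L′ f ≡ sumN L f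
sumN-extend L L′ f L≤L′ p = begin
    sumN L′ f
  ≡⟨ cong (λ x → sumN x f) (sym (m+[n∸m]≡n L≤L′)) ⟩
    sumN (L + (L′ ∸ L)) f
  ≡⟨ sumN-split L (L′ ∸ L) f ⟩
    sumN L f + sumN (L′ ∸ L) (λ i → f (L + i))
  ≡⟨ cong (sumN L f +_) (sumN-zero (L′ ∸ L) _ (λ i i< → p (L + i) (m≤m+n L i)
         (subst (L + i <_) (m+[n∸m]≡n L≤L′) (+-monoʳ-< L i<)))) ⟩
    sumN L f + 0
  ≡⟨ +-identityʳ _ ⟩
    sumN L f
  ∎ where open ≡-Reasoning

sumN-reverse : ∀ L f → sumN L (λ k → f (L ∸ suc k)) ≡ sumN L f
sumN-reverse zero f = refl
sumN-reverse (suc L) f = begin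
    f L + sumN L (λ k → f (L ∸ suc k))   ≡⟨ cong (f L +_) (sumN-reverse L f) ⟩
    f L + sumN L f                       ≡⟨ +-comm (f L) _ ⟩
    sumN L f + f L                       ≡⟨ sym (sumN-snoc L f) ⟩
    sumN (suc L) f                       ∎ where open ≡-Reasoning

sumS : ℕ → (ℕ → Series) → Series
sumS L F n = sumN L (λ i → F i n)

sumS-cong : ∀ L {F G} → (∀ i → i < L → F i ≈ G i) → sumS L F ≈ sumS L G
sumS-cong L p n = sumN-cong L (λ i i<L → p i i<L n)

sumS-⊕ : ∀ L F G → sumS L (λ i → F i ⊕ G i) ≈ sumS L F ⊕ sumS L G
sumS-⊕ L F G n = sumN-+ L (λ i → F i n) (λ i → G i n)

sumS-snoc : ∀ L F → sumS (suc L) F ≈ sumS L F ⊕ F L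
sumS-snoc L F n = sumN-snoc L (λ i → F i n)

sumS-drop-last : ∀ L F → F L ≈ 𝟘 → sumS (suc L) F ≈ sumS L F
sumS-drop-last L F zero-last = ≈trans (sumS-snoc L F) (λ n → trans (cong (sumS L F n +_) (zero-last n)) (+-identityʳ _))

sumS-split : ∀ a b F → sumS (a + b) F ≈ sumS a F ⊕ sumS b (λ i → F (a + i))
sumS-split a b F n = sumN-split a b (λ i → F i n)

sumS-⊛ : ∀ L F G → sumS L F ⊛ G ≈ sumS L (λ i → F i ⊛ G)
sumS-⊛ zero F G n = ⊛-zeroˡ G n
sumS-⊛ (suc L) F G n = trans (⊛-distribʳ (F 0) (sumS L (λ i → F (suc i))) G n)
                             (cong ((F 0 ⊛ G) n +_) (sumS-⊛ L (λ i → F (suc i)) G n))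

⊛-sumS : ∀ L H F → H ⊛ sumS L F ≈ sumS L (λ i → H ⊛ F i)
⊛-sumS L H F = ≈trans (⊛-comm _ _) (≈trans (sumS-⊛ L F H) (sumS-cong L (λ i _ → ⊛-comm _ _)))

prodS : ℕ → (ℕ → Series) → Series
prodS zero F = δ
prodS (suc N) F = F N ⊛ prodS N F

prodS-cong : ∀ N {F G} → (∀ i → i < N → F i ≈ G i) → prodS N F ≈ prodS N G
prodS-cong zero p = ≈refl
prodS-cong (suc N) p = ⊛-cong (p N ≤-refl) (prodS-cong N (λ i i<N → p i (m≤n⇒m≤1+n i<N)))

prodS-split : ∀ a b F → prodS (a + b) F ≈ prodS b (λ i → F (a + i)) ⊛ prodS a F
prodS-split a zero F n = trans (cong (λ x → prodS x F n) (+-identityʳ a)) (sym (⊛-identityˡ (prodS a F) n))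
prodS-split a (suc b) F = begin
    prodS (a + suc b) F
  ≈⟨ (λ n → cong (λ x → prodS x F n) (+-suc a b)) ⟩
    F (a + b) ⊛ prodS (a + b) F
  ≈⟨ ⊛-cong ≈refl (prodS-split a b F) ⟩
    F (a + b) ⊛ (prodS b (λ i → F (a + i)) ⊛ prodS a F)
  ≈⟨ ≈sym (⊛-assoc _ _ _) ⟩
    prodS (suc b) (λ i → F (a + i)) ⊛ prodS a F
  ∎ where open ≈-Reasoning

prodS-⊛ : ∀ N F G → prodS N (λ i → F i ⊛ G i) ≈ prodS N F ⊛ prodS N G
prodS-⊛ zero F G = ≈sym (⊛-identityˡ δ)
prodS-⊛ (suc N) F G = ≈trans (⊛-cong ≈refl (prodS-⊛ N F G))
   (solve 4 (λ a b c d → (a :* b) :* (c :* d) := (a :* c) :* (b :* d)) ≈refl (F N) (G N) (prodS N F) (prodS N G))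

N∸i≡1+N∸[1+i] : ∀ N i → i < N → N ∸ i ≡ suc (N ∸ suc i)
N∸i≡1+N∸[1+i] N i i<N = +-∸-assoc 1 i<N

prodS-reverse : ∀ N F → prodS N (λ i → F (N ∸ suc i)) ≈ prodS N F
prodS-reverse zero F = ≈refl
prodS-reverse (suc N) F = begin
    F (N ∸ N) ⊛ prodS N (λ i → F (N ∸ i))
  ≈⟨ ⊛-cong (λ n → cong (λ x → F x n) (n∸n≡0 N))
            (prodS-cong N (λ i i<N n → cong (λ x → F x n) (N∸i≡1+N∸[1+i] N i i<N))) ⟩
    F 0 ⊛ prodS N (λ i → F (suc (N ∸ suc i)))
  ≈⟨ ⊛-cong ≈refl (prodS-reverse N (λ j → F (suc j))) ⟩
    F 0 ⊛ prodS N (λ j → F (suc j))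
  ≈⟨ ⊛-comm _ _ ⟩
    prodS N (λ j → F (suc j)) ⊛ F 0
  ≈⟨ ⊛-cong ≈refl (≈sym (⊛-identityʳ (F 0))) ⟩
    prodS N (λ j → F (1 + j)) ⊛ prodS 1 F
  ≈⟨ ≈sym (prodS-split 1 N F) ⟩
    prodS (suc N) F
  ∎ where open ≈-Reasoning

prodS-const : ∀ N a → prodS N (λ _ → X a) ≈ X (N * a)
prodS-const zero a = ≈refl
prodS-const (suc N) a = ≈trans (⊛-cong ≈refl (prodS-const N a)) (≈sym (X-+ a (N * a)))

≤ᵇ-true : ∀ {m n} → m ≤ n → (m ≤ᵇ n) ≡ true
≤ᵇ-true {m} {n} = dec-true (m ≤? n)

≤ᵇ-false : ∀ {m n} → ¬ (m ≤ n) → (m ≤ᵇ n) ≡ false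
≤ᵇ-false {m} {n} = dec-false (m ≤? n)

≤ᵇ-+ : ∀ a x y → (a + x ≤ᵇ a + y) ≡ (x ≤ᵇ y)
≤ᵇ-+ a x y with x ≤? y
... | yes x≤y = trans (≤ᵇ-true (+-monoʳ-≤ a x≤y)) (sym (≤ᵇ-true x≤y))
... | no x≰y = trans (≤ᵇ-false (λ h → x≰y (+-cancelˡ-≤ a x y h))) (sym (≤ᵇ-false x≰y))

if-same : ∀ {A : Set} b (x : A) → (if b then x else x) ≡ x
if-same true x = refl
if-same false x = refl

shift-value : ∀ c f n → shift c f n ≡ (if c ≤ᵇ n then f (n ∸ c) else 0)
shift-value c f n with c ≤? n
... | yes c≤n rewrite ≤ᵇ-true c≤n =
  trans (cong (shift c f) (sym (m+[n∸m]≡n c≤n))) (shift-≥ c f (n ∸ c))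
... | no c≰n rewrite ≤ᵇ-false c≰n = shift-< c f n (≰⇒> c≰n)

length-filter-++ : ∀ {A : Set} (P : A → Bool) xs ys →
  length (filterᵇ P (xs ++ ys)) ≡ length (filterᵇ P xs) + length (filterᵇ P ys)
length-filter-++ P [] ys = refl
length-filter-++ P (x ∷ xs) ys with P x
... | true = cong suc (length-filter-++ P xs ys)
... | false = length-filter-++ P xs ys

length-filter-concatMap : ∀ {A B : Set} (P : B → Bool) (F : A → List B) L →
  length (filterᵇ P (concatMap F L)) ≡ sum (map (λ x → length (filterᵇ P (F x))) L)
length-filter-concatMap P F [] = refl
length-filter-concatMap P F (x ∷ L) =
  trans (length-filter-++ P (F x) (concatMap F L)) (cong (length (filterᵇ P (F x)) +_) (length-filter-concatMap P F L))

length-filter-map : ∀ {A B : Set} (P : B → Bool) (g : A → B) L →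
  length (filterᵇ P (map g L)) ≡ length (filterᵇ (λ x → P (g x)) L)
length-filter-map P g [] = refl
length-filter-map P g (x ∷ L) with P (g x)
... | true = cong suc (length-filter-map P g L)
... | false = length-filter-map P g L

length-filter-cong : ∀ {A : Set} (P Q : A → Bool) L → All (λ x → P x ≡ Q x) L →
  length (filterᵇ P L) ≡ length (filterᵇ Q L)
length-filter-cong P Q [] [] = refl
length-filter-cong P Q (x ∷ L) (e ∷ es) with P x | Q x
... | true | true = cong suc (length-filter-cong P Q L es)
... | false | false = length-filter-cong P Q L es
... | true | false = case e of λ ()
... | false | true = case e of λ ()

length-filter-false : ∀ {A : Set} (L : List A) → length (filterᵇ (λ _ → false) L) ≡ 0
length-filter-false [] = refl
length-filter-false (x ∷ L) = length-filter-false L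

length-filter-true : ∀ {A : Set} (L : List A) → length (filterᵇ (λ _ → true) L) ≡ length L
length-filter-true [] = refl
length-filter-true (x ∷ L) = cong suc (length-filter-true L)

sum-map-applyUpTo : ∀ (h g : ℕ → ℕ) L → sum (map h (applyUpTo g L)) ≡ sumN L (λ m → h (g m))
sum-map-applyUpTo h g zero = refl
sum-map-applyUpTo h g (suc L) = cong (h (g 0) +_) (sum-map-applyUpTo h (λ i → g (suc i)) L)

sum-filter-applyUpTo : ∀ (q : ℕ → Bool) (h g : ℕ → ℕ) L →
  sum (map h (filterᵇ q (applyUpTo g L))) ≡ sumN L (λ m → if q (g m) then h (g m) else 0)
sum-filter-applyUpTo q h g zero = refl
sum-filter-applyUpTo q h g (suc L) with q (g 0)
... | true = cong (h (g 0) +_) (sum-filter-applyUpTo q h (λ i → g (suc i)) L)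
... | false = sum-filter-applyUpTo q h (λ i → g (suc i)) L

count : (List ℕ → Bool) → ℕ → Series
count P k n = length (filterᵇ P (partitionsBounded k n))

-- Partitions with parts ≤ k+1 whose part k+1 occurs exactly m times, counted by P; the
-- remaining parts form a partition of x = n − m(k+1) with parts ≤ k.
countTop : (List ℕ → Bool) → ℕ → ℕ → Series
countTop P k m x = length (filterᵇ (λ l → P (replicate m (suc k) ++ l)) (partitionsBounded k x))

multSum : ℕ → (ℕ → Series) → Series
multSum c g n = sumN (suc n) (λ m → if m * c ≤ᵇ n then g m (n ∸ m * c) else 0)

-- Classifying partitions with parts ≤ k+1 by the multiplicity of the part k+1, which is
-- exactly how partitionsBounded generates them.
count-suc : ∀ P k → count P (suc k) ≈ multSum (suc k) (countTop P k)
count-suc P k n =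
  trans (length-filter-concatMap P G (filterᵇ (λ m → m * suc k ≤ᵇ n) (upTo (suc n))))
   (trans (sum-filter-applyUpTo (λ m → m * suc k ≤ᵇ n) (λ m → length (filterᵇ P (G m))) (λ m → m) (suc n))
     (sumN-cong (suc n) (λ m _ → cong (λ x → if m * suc k ≤ᵇ n then x else 0)
        (length-filter-map P (replicate m (suc k) ++_) (partitionsBounded k (n ∸ m * suc k))))))
  where G : ℕ → List (List ℕ)
        G m = map (replicate m (suc k) ++_) (partitionsBounded k (n ∸ m * suc k))

count-zero : ∀ P → P [] ≡ true → count P 0 ≈ δ
count-zero P P[] zero rewrite P[] = refl
count-zero P P[] (suc n) = refl

partitionsBounded-≤ : ∀ k n → All (All (_≤ k)) (partitionsBounded k n)
partitionsBounded-≤ zero zero = [] ∷ []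
partitionsBounded-≤ zero (suc n) = []
partitionsBounded-≤ (suc k) n = AllP.concat⁺ (AllP.map⁺ (All.universal (λ m →
   AllP.map⁺ (All.map (λ al → AllP.++⁺ (AllP.replicate⁺ m ≤-refl) (All.map m≤n⇒m≤1+n al))
                      (partitionsBounded-≤ k (n ∸ m * suc k)))) multiplicities))
  where multiplicities : List ℕ
        multiplicities = filterᵇ (λ m → m * suc k ≤ᵇ n) (upTo (suc n))

multSum-cong : ∀ c {g g′} → (∀ m → g m ≈ g′ m) → multSum c g ≈ multSum c g′
multSum-cong c e n = sumN-cong (suc n) (λ m _ → cong (λ v → if m * c ≤ᵇ n then v else 0) (e m (n ∸ m * c)))

multSum-peel-≥ : ∀ k g r →
  multSum (suc k) g (suc k + r) ≡ g 0 (suc k + r) + multSum (suc k) (λ m → g (suc m)) r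
multSum-peel-≥ k g r = cong (g 0 (suc k + r) +_) (begin
    sumN (suc k + r) (λ m → if suc m * suc k ≤ᵇ suc k + r then g (suc m) ((suc k + r) ∸ suc m * suc k) else 0)
  ≡⟨ sumN-cong (suc k + r) (λ m _ → cong₂ (λ b x → if b then g (suc m) x else 0)
        (≤ᵇ-+ (suc k) (m * suc k) r) ([m+n]∸[m+o]≡n∸o (suc k) r (m * suc k))) ⟩
    sumN (suc k + r) term
  ≡⟨ sumN-extend (suc r) (suc k + r) term (s≤s (m≤n+m r k)) vanish ⟩
    sumN (suc r) term
  ∎)
  where
  open ≡-Reasoning
  term : ℕ → ℕ
  term m = if m * suc k ≤ᵇ r then g (suc m) (r ∸ m * suc k) else 0
  vanish : ∀ i → suc r ≤ i → i < suc k + r → term i ≡ 0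
  vanish i r<i _ = cong (λ b → if b then g (suc i) (r ∸ i * suc k) else 0)
                        (≤ᵇ-false (λ h → <⇒≱ r<i (≤-trans (m≤m*n i (suc k)) h)))

multSum-peel-< : ∀ k g n → n < suc k → multSum (suc k) g n ≡ g 0 n
multSum-peel-< k g n n<c = trans (cong (g 0 n +_) (sumN-zero n _ (λ m _ →
    cong (λ b → if b then g (suc m) (n ∸ suc m * suc k) else 0)
         (≤ᵇ-false (λ h → <⇒≱ n<c (≤-trans (m≤m+n (suc k) (m * suc k)) h))))))
  (+-identityʳ _)

multSum-peel : ∀ k g → multSum (suc k) g ≈ g 0 ⊕ shift (suc k) (multSum (suc k) (λ m → g (suc m)))
multSum-peel k g n with suc k ≤? n
... | yes c≤n = begin
    multSum (suc k) g n
  ≡⟨ cong (multSum (suc k) g) (sym (m+[n∸m]≡n c≤n)) ⟩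
    multSum (suc k) g (suc k + r)
  ≡⟨ multSum-peel-≥ k g r ⟩
    g 0 (suc k + r) + multSum (suc k) (λ m → g (suc m)) r
  ≡⟨ cong₂ _+_ (cong (g 0) (m+[n∸m]≡n c≤n)) (sym (shift-≥ (suc k) _ r)) ⟩
    g 0 n + shift (suc k) (multSum (suc k) (λ m → g (suc m))) (suc k + r)
  ≡⟨ cong (λ x → g 0 n + shift (suc k) (multSum (suc k) (λ m → g (suc m))) x) (m+[n∸m]≡n c≤n) ⟩
    g 0 n + shift (suc k) (multSum (suc k) (λ m → g (suc m))) n
  ∎ where
  open ≡-Reasoning
  r = n ∸ suc k
... | no c≰n = trans (multSum-peel-< k g n (≰⇒> c≰n))
                     (sym (trans (cong (g 0 n +_) (shift-< (suc k) _ n (≰⇒> c≰n))) (+-identityʳ _)))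

multSum-head : ∀ k g → (∀ m → g (suc m) ≈ 𝟘) → multSum (suc k) g ≈ g 0
multSum-head k g none n = begin
    multSum (suc k) g n
  ≡⟨ multSum-peel k g n ⟩
    g 0 n + shift (suc k) (multSum (suc k) (λ m → g (suc m))) n
  ≡⟨ cong (g 0 n +_) (shift-cong (suc k) (multSum-cong (suc k) none) n) ⟩
    g 0 n + shift (suc k) (multSum (suc k) (λ _ → 𝟘)) n
  ≡⟨ cong (g 0 n +_) (trans (shift-value (suc k) _ n) (cong (λ v → if suc k ≤ᵇ n then v else 0) (zeros (n ∸ suc k)))) ⟩
    g 0 n + (if suc k ≤ᵇ n then 0 else 0)
  ≡⟨ trans (cong (g 0 n +_) (if-same (suc k ≤ᵇ n) 0)) (+-identityʳ _) ⟩
    g 0 n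
  ∎ where
  open ≡-Reasoning
  zeros : ∀ x → multSum (suc k) (λ _ → 𝟘) x ≡ 0
  zeros x = sumN-zero (suc x) _ (λ m _ → if-same (m * suc k ≤ᵇ x) 0)

Pk Dk Ok : ℕ → Series
Pk = count (λ _ → true)
Dk = count distinctParts
Ok = count allOdd

Pk-zero : Pk 0 ≈ δ
Pk-zero = count-zero (λ _ → true) refl

Dk-zero : Dk 0 ≈ δ
Dk-zero = count-zero distinctParts refl

Ok-zero : Ok 0 ≈ δ
Ok-zero = count-zero allOdd refl

-- Functional equation of 1/((1−q)⋯(1−q^(k+1))): the part k+1 may occur any number of times.
Pk-rec : ∀ k → Pk (suc k) ≈ Pk k ⊕ shift (suc k) (Pk (suc k))
Pk-rec k = begin
    Pk (suc k)
  ≈⟨ count-suc (λ _ → true) k ⟩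
    multSum (suc k) (λ _ → Pk k)
  ≈⟨ multSum-peel k (λ _ → Pk k) ⟩
    Pk k ⊕ shift (suc k) (multSum (suc k) (λ _ → Pk k))
  ≈⟨ ⊕-cong ≈refl (shift-cong (suc k) (≈sym (count-suc (λ _ → true) k))) ⟩
    Pk k ⊕ shift (suc k) (Pk (suc k))
  ∎ where open ≈-Reasoning

notIn-larger : ∀ k l → All (_≤ k) l → notIn (suc k) l ≡ true
notIn-larger k [] [] = refl
notIn-larger k (y ∷ l) (y≤k ∷ al)
  rewrite dec-false (suc k ≟ y) (λ k+1≡y → <⇒≱ (s≤s y≤k) (≤-reflexive k+1≡y)) = notIn-larger k l al

countTop-distinct-once : ∀ k → countTop distinctParts k 1 ≈ Dk k
countTop-distinct-once k x =
  length-filter-cong (λ l → distinctParts (suc k ∷ l)) distinctParts (partitionsBounded k x)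
    (All.map (λ {l} al → cong (_∧ distinctParts l) (notIn-larger k l al)) (partitionsBounded-≤ k x))

countTop-distinct-twice : ∀ k m → countTop distinctParts k (suc (suc m)) ≈ 𝟘
countTop-distinct-twice k m x =
  trans (length-filter-cong _ (λ _ → false) (partitionsBounded k x) (All.universal repeated _))
        (length-filter-false (partitionsBounded k x))
  where
  repeated : ∀ l → distinctParts (replicate (suc (suc m)) (suc k) ++ l) ≡ false
  repeated l rewrite dec-true (suc k ≟ suc k) refl = refl

Dk-rec : ∀ k → Dk (suc k) ≈ Dk k ⊕ shift (suc k) (Dk k)
Dk-rec k = begin
    Dk (suc k)
  ≈⟨ count-suc distinctParts k ⟩
    multSum (suc k) G
  ≈⟨ multSum-peel k G ⟩
    Dk k ⊕ shift (suc k) (multSum (suc k) (λ m → G (suc m)))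
  ≈⟨ ⊕-cong ≈refl (shift-cong (suc k) (multSum-head k (λ m → G (suc m)) (countTop-distinct-twice k))) ⟩
    Dk k ⊕ shift (suc k) (G 1)
  ≈⟨ ⊕-cong ≈refl (shift-cong (suc k) (countTop-distinct-once k)) ⟩
    Dk k ⊕ shift (suc k) (Dk k)
  ∎ where
  open ≈-Reasoning
  G : ℕ → Series
  G = countTop distinctParts k

allOdd-replicate : ∀ m c l → allOdd (replicate (suc m) c ++ l) ≡ isOdd c ∧ allOdd l
allOdd-replicate zero c l = refl
allOdd-replicate (suc m) c l =
  trans (cong (isOdd c ∧_) (allOdd-replicate m c l)) (∧-idem (isOdd c) (allOdd l))
  where ∧-idem : ∀ a b → a ∧ (a ∧ b) ≡ a ∧ b
        ∧-idem true b = refl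
        ∧-idem false b = refl

countTop-odd : ∀ k m → countTop allOdd k (suc m) ≈ (if isOdd (suc k) then Ok k else 𝟘)
countTop-odd k m x =
  trans (length-filter-cong _ (λ l → isOdd (suc k) ∧ allOdd l) (partitionsBounded k x)
                            (All.universal (allOdd-replicate m (suc k)) _))
        (by-parity (isOdd (suc k)))
  where
  by-parity : ∀ b → length (filterᵇ (λ l → b ∧ allOdd l) (partitionsBounded k x)) ≡ (if b then Ok k else 𝟘) x
  by-parity true = refl
  by-parity false = length-filter-false (partitionsBounded k x)

Ok-rec-odd : ∀ k → isOdd (suc k) ≡ true → Ok (suc k) ≈ Ok k ⊕ shift (suc k) (Ok (suc k))
Ok-rec-odd k odd = begin
    Ok (suc k)
  ≈⟨ count-suc allOdd k ⟩
    multSum (suc k) G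
  ≈⟨ multSum-peel k G ⟩
    Ok k ⊕ shift (suc k) (multSum (suc k) (λ m → G (suc m)))
  ≈⟨ ⊕-cong ≈refl (shift-cong (suc k) (multSum-cong (suc k) allOk)) ⟩
    Ok k ⊕ shift (suc k) (multSum (suc k) G)
  ≈⟨ ⊕-cong ≈refl (shift-cong (suc k) (≈sym (count-suc allOdd k))) ⟩
    Ok k ⊕ shift (suc k) (Ok (suc k))
  ∎ where
  open ≈-Reasoning
  G : ℕ → Series
  G = countTop allOdd k
  allOk : ∀ m → G (suc m) ≈ G m
  allOk zero x rewrite countTop-odd k 0 x | odd = refl
  allOk (suc m) x rewrite countTop-odd k (suc m) x | countTop-odd k m x = refl

Ok-rec-even : ∀ k → isOdd (suc k) ≡ false → Ok (suc k) ≈ Ok k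
Ok-rec-even k even = ≈trans (count-suc allOdd k) (multSum-head k (countTop allOdd k) none)
  where none : ∀ m → countTop allOdd k (suc m) ≈ 𝟘
        none m x rewrite countTop-odd k m x | even = refl

-- A family of truncations is stable if raising the bound past k leaves the coefficients
-- of degree ≤ k unchanged; it then agrees up to degree k with its diagonal, the limit.
Stable : (ℕ → Series) → Set
Stable F = ∀ k n → n ≤ k → F (suc k) n ≡ F k n

lim : (ℕ → Series) → Series
lim F n = F n n

lim-upto : ∀ {F} → Stable F → ∀ k n → n ≤ k → F k ≈[ n ] lim F
lim-upto {F} stable k n n≤k i i≤n = subst (λ k → F k i ≡ F i i) (m+[n∸m]≡n i≤k) (from-diagonal (k ∸ i))
  where
  i≤k : i ≤ k
  i≤k = ≤-trans i≤n n≤k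
  from-diagonal : ∀ j → F (i + j) i ≡ F i i
  from-diagonal zero = cong (λ x → F x i) (+-identityʳ i)
  from-diagonal (suc j) = trans (cong (λ x → F x i) (+-suc i j)) (trans (stable (i + j) i (m≤m+n i j)) (from-diagonal j))

P∞ D∞ O∞ : Series
P∞ = lim Pk
D∞ = lim Dk
O∞ = lim Ok

Pk-stable : Stable Pk
Pk-stable k n n≤k = trans (Pk-rec k n) (⊕-shift-low k (Pk k) _ n n≤k)

Dk-stable : Stable Dk
Dk-stable k n n≤k = trans (Dk-rec k n) (⊕-shift-low k (Dk k) _ n n≤k)

Ok-stable : Stable Ok
Ok-stable k n n≤k with isOdd (suc k) in parity
... | true = trans (Ok-rec-odd k parity n) (⊕-shift-low k (Ok k) _ n n≤k)
... | false = Ok-rec-even k parity n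

par : ℕ → Bool
par zero = false
par (suc zero) = true
par (suc (suc n)) = par n

isOdd-par : ∀ n → isOdd n ≡ par n
isOdd-par zero = refl
isOdd-par (suc zero) = refl
isOdd-par (suc (suc n)) =
  trans (cong (λ r → does (r ≟ 1)) (trans (cong (_% 2) (+-comm 2 n)) ([m+n]%n≡m%n n 2))) (isOdd-par n)

par-suc : ∀ n → par (suc n) ≡ not (par n)
par-suc zero = refl
par-suc (suc zero) = refl
par-suc (suc (suc n)) = par-suc n

par-+ : ∀ a b → par (a + b) ≡ par a xor par b
par-+ zero b = refl
par-+ (suc a) b = begin
    par (suc (a + b))          ≡⟨ par-suc (a + b) ⟩
    not (par (a + b))          ≡⟨ cong not (par-+ a b) ⟩
    not (par a xor par b)      ≡⟨ not-distribˡ-xor (par a) (par b) ⟩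
    not (par a) xor par b      ≡⟨ cong (_xor par b) (sym (par-suc a)) ⟩
    par (suc a) xor par b      ∎ where open ≡-Reasoning

par-double : ∀ y → par (y + y) ≡ false
par-double y = trans (par-+ y y) (xor-same (par y))

par-double+1 : ∀ y → par (suc (y + y)) ≡ true
par-double+1 y = trans (par-suc (y + y)) (cong not (par-double y))

even-or-odd : ∀ x → ∃ (λ y → x ≡ y + y) ⊎ ∃ (λ y → x ≡ suc (y + y))
even-or-odd zero = inj₁ (0 , refl)
even-or-odd (suc x) with even-or-odd x
... | inj₁ (y , refl) = inj₂ (y , refl)
... | inj₂ (y , refl) = inj₁ (suc y , cong suc (sym (+-suc y y)))

y*2≡y+y : ∀ y → y * 2 ≡ y + y
y*2≡y+y y = trans (*-comm y 2) (cong (y +_) (+-identityʳ y))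

par-of-even : ∀ {n} → 2 ∣ n → par n ≡ false
par-of-even (divides q refl) = trans (cong par (y*2≡y+y q)) (par-double q)

par-of-odd : ∀ {n} → ¬ (2 ∣ n) → par n ≡ true
par-of-odd {n} 2∤n with even-or-odd n
... | inj₁ (y , refl) = ⊥-elim (2∤n (divides y (sym (y*2≡y+y y))))
... | inj₂ (y , refl) = par-double+1 y

half-double : ∀ y → (y + y) / 2 ≡ y
half-double y = trans (cong (_/ 2) (sym (y*2≡y+y y))) (m*n/n≡m y 2)

double-injective : ∀ x y → x + x ≡ y + y → x ≡ y
double-injective x y eq = *-cancelʳ-≡ x y 2 (trans (y*2≡y+y x) (trans eq (sym (y*2≡y+y y))))

dilate : Series → Series
dilate f zero = f 0
dilate f (suc zero) = 0
dilate f (suc (suc x)) = dilate (tail f) x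

dilate-double : ∀ f y → dilate f (y + y) ≡ f y
dilate-double f zero = refl
dilate-double f (suc y) = trans (cong (λ x → dilate f (suc x)) (+-suc y y)) (dilate-double (tail f) y)

dilate-double+1 : ∀ f y → dilate f (suc (y + y)) ≡ 0
dilate-double+1 f zero = refl
dilate-double+1 f (suc y) = trans (cong (λ x → dilate f (suc (suc x))) (+-suc y y)) (dilate-double+1 (tail f) y)

dilate-cong : ∀ {f g} → f ≈ g → dilate f ≈ dilate g
dilate-cong p zero = p 0
dilate-cong p (suc zero) = refl
dilate-cong p (suc (suc x)) = dilate-cong (λ i → p (suc i)) x

dilate-upto : ∀ n {f g} → f ≈[ n ] g → dilate f ≈[ n ] dilate g
dilate-upto n p zero _ = p 0 z≤n
dilate-upto n p (suc zero) _ = refl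
dilate-upto (suc (suc n)) p (suc (suc x)) (s≤s (s≤s x≤n)) =
  dilate-upto n (λ j j≤n → p (suc j) (s≤s (m≤n⇒m≤1+n j≤n))) x x≤n

dilate-⊕ : ∀ f g → dilate (f ⊕ g) ≈ dilate f ⊕ dilate g
dilate-⊕ f g zero = refl
dilate-⊕ f g (suc zero) = refl
dilate-⊕ f g (suc (suc x)) = dilate-⊕ (tail f) (tail g) x

dilate-δ : dilate δ ≈ δ
dilate-δ zero = refl
dilate-δ (suc zero) = refl
dilate-δ (suc (suc x)) = dilate-𝟘 x
  where dilate-𝟘 : dilate 𝟘 ≈ 𝟘
        dilate-𝟘 zero = refl
        dilate-𝟘 (suc zero) = refl
        dilate-𝟘 (suc (suc x)) = dilate-𝟘 x

dilate-shift1 : ∀ f → dilate (shift1 f) ≈ shift1 (shift1 (dilate f))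
dilate-shift1 f zero = refl
dilate-shift1 f (suc zero) = refl
dilate-shift1 f (suc (suc x)) = refl

dilate-shift : ∀ c f → dilate (shift c f) ≈ shift (c + c) (dilate f)
dilate-shift zero f = ≈refl
dilate-shift (suc c) f = ≈trans (dilate-shift1 (shift c f)) (≈trans (shift1-cong (shift1-cong (dilate-shift c f)))
   (λ n → cong (λ x → shift x (dilate f) n) (sym (cong suc (+-suc c c)))))

Pk² : ℕ → Series
Pk² k = dilate (Pk k)

P∞² : Series
P∞² = dilate P∞

Pk²-upto : ∀ k n → n ≤ k → Pk² k ≈[ n ] P∞²
Pk²-upto k n n≤k = dilate-upto n (lim-upto Pk-stable k n n≤k)

Pk-unique : ∀ k {Y} → Y ≈ Pk k ⊕ X (suc k) ⊛ Y → Y ≈ Pk (suc k)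
Pk-unique k {Y} hY = unique-fixpoint k (≈trans hY (⊕-cong ≈refl (≈sym (shift-X (suc k) Y)))) (Pk-rec k)

-- The functional equations of P² and D, written with monomials for use with the solver.
Pk²-rec : ∀ k → Pk² (suc k) ≈ Pk² k ⊕ X (suc k + suc k) ⊛ Pk² (suc k)
Pk²-rec k = ≈trans (dilate-cong (Pk-rec k)) (≈trans (dilate-⊕ _ _)
              (⊕-cong ≈refl (≈trans (dilate-shift (suc k) (Pk (suc k))) (shift-X (suc k + suc k) _))))

Dk-rec-X : ∀ k → Dk (suc k) ≈ Dk k ⊕ X (suc k) ⊛ Dk k
Dk-rec-X k = ≈trans (Dk-rec k) (⊕-cong ≈refl (shift-X (suc k) (Dk k)))

Dk-Pk² : ∀ N → Dk N ⊛ Pk² N ≈ Pk N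
Dk-Pk² zero = ≈trans (⊛-cong Dk-zero (≈trans (dilate-cong Pk-zero) dilate-δ)) (≈trans (⊛-identityˡ δ) (≈sym Pk-zero))
Dk-Pk² (suc N) = Pk-unique N (begin
    Dk (suc N) ⊛ W
  ≈⟨ ⊛-cong (Dk-rec-X N) ≈refl ⟩
    (Z ⊕ u ⊛ Z) ⊛ W
  ≈⟨ solve 3 (λ z u w → (z :+ u :* z) :* w := z :* w :+ u :* (z :* w)) ≈refl Z u W ⟩
    Z ⊛ W ⊕ u ⊛ (Z ⊛ W)
  ≈⟨ ⊕-cong (⊛-cong ≈refl hW) ≈refl ⟩
    Z ⊛ (E ⊕ (u ⊛ u) ⊛ W) ⊕ u ⊛ (Z ⊛ W)
  ≈⟨ solve 4 (λ z e u w → z :* (e :+ (u :* u) :* w) :+ u :* (z :* w) := z :* e :+ u :* ((z :+ u :* z) :* w)) ≈refl Z E u W ⟩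
    Z ⊛ E ⊕ u ⊛ ((Z ⊕ u ⊛ Z) ⊛ W)
  ≈⟨ ⊕-cong (Dk-Pk² N) (⊛-cong ≈refl (⊛-cong (≈sym (Dk-rec-X N)) ≈refl)) ⟩
    Pk N ⊕ u ⊛ (Dk (suc N) ⊛ W)
  ∎)
  where
  open ≈-Reasoning
  u Z E W : Series
  u = X (suc N)
  Z = Dk N
  E = Pk² N
  W = Pk² (suc N)
  hW : W ≈ E ⊕ (u ⊛ u) ⊛ W
  hW = ≈trans (Pk²-rec N) (⊕-cong ≈refl (⊛-cong (X-+ (suc N) (suc N)) ≈refl))

-- Admitting the odd
-- part 2N+1 changes O and P by the same factor 1/(1 − q^(2N+1)); admitting the even part
-- 2N+2 leaves O unchanged and changes P² and P by the same factor 1/(1 − q^(2N+2)).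
Ok-Pk²-odd-step : ∀ N → Ok (N + N) ⊛ Pk² N ≈ Pk (N + N) → Ok (suc (N + N)) ⊛ Pk² N ≈ Pk (suc (N + N))
Ok-Pk²-odd-step N ih = Pk-unique M (begin
    Ok (suc M) ⊛ Pk² N
  ≈⟨ ⊛-cong hO ≈refl ⟩
    (Ok M ⊕ v ⊛ Ok (suc M)) ⊛ Pk² N
  ≈⟨ solve 4 (λ a v b e → (a :+ v :* b) :* e := a :* e :+ v :* (b :* e)) ≈refl (Ok M) v (Ok (suc M)) (Pk² N) ⟩
    Ok M ⊛ Pk² N ⊕ v ⊛ (Ok (suc M) ⊛ Pk² N)
  ≈⟨ ⊕-cong ih ≈refl ⟩
    Pk M ⊕ v ⊛ (Ok (suc M) ⊛ Pk² N)
  ∎)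
  where
  open ≈-Reasoning
  M : ℕ
  M = N + N
  v : Series
  v = X (suc M)
  hO : Ok (suc M) ≈ Ok M ⊕ v ⊛ Ok (suc M)
  hO = ≈trans (Ok-rec-odd M (trans (isOdd-par (suc M)) (par-double+1 N))) (⊕-cong ≈refl (shift-X (suc M) _))

Ok-Pk²-even-step : ∀ N → Ok (suc (N + N)) ⊛ Pk² N ≈ Pk (suc (N + N)) →
  Ok (suc (suc (N + N))) ⊛ Pk² (suc N) ≈ Pk (suc (suc (N + N)))
Ok-Pk²-even-step N ih = Pk-unique (suc M) (begin
    Ok (suc (suc M)) ⊛ W
  ≈⟨ ⊛-cong no-new-part hW ⟩
    Ok (suc M) ⊛ (Pk² N ⊕ v ⊛ W)
  ≈⟨ solve 4 (λ a e v w → a :* (e :+ v :* w) := a :* e :+ v :* (a :* w)) ≈refl (Ok (suc M)) (Pk² N) v W ⟩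
    Ok (suc M) ⊛ Pk² N ⊕ v ⊛ (Ok (suc M) ⊛ W)
  ≈⟨ ⊕-cong ih (⊛-cong ≈refl (⊛-cong (≈sym no-new-part) ≈refl)) ⟩
    Pk (suc M) ⊕ v ⊛ (Ok (suc (suc M)) ⊛ W)
  ∎)
  where
  open ≈-Reasoning
  M : ℕ
  M = N + N
  v W : Series
  v = X (suc (suc M))
  W = Pk² (suc N)
  no-new-part : Ok (suc (suc M)) ≈ Ok (suc M)
  no-new-part = Ok-rec-even (suc M) (trans (isOdd-par (suc (suc M))) (par-double N))
  hW : W ≈ Pk² N ⊕ v ⊛ W
  hW = ≈trans (Pk²-rec N) (⊕-cong ≈refl (⊛-cong (X-cong (cong suc (+-suc N N))) ≈refl))

Ok-Pk² : ∀ N → Ok (N + N) ⊛ Pk² N ≈ Pk (N + N)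
Ok-Pk² zero = ≈trans (⊛-cong Ok-zero (≈trans (dilate-cong Pk-zero) dilate-δ)) (≈trans (⊛-identityˡ δ) (≈sym Pk-zero))
Ok-Pk² (suc N) rewrite +-suc N N = Ok-Pk²-even-step N (Ok-Pk²-odd-step N (Ok-Pk² N))

D∞-P∞² : D∞ ⊛ P∞² ≈ P∞
D∞-P∞² n = begin
    (D∞ ⊛ P∞²) n
  ≡⟨ sym (⊛-cong-upto n (lim-upto Dk-stable n n ≤-refl) (Pk²-upto n n ≤-refl)) ⟩
    (Dk n ⊛ Pk² n) n
  ≡⟨ Dk-Pk² n n ⟩
    Pk n n
  ∎ where open ≡-Reasoning

O∞-P∞² : O∞ ⊛ P∞² ≈ P∞
O∞-P∞² n = begin
    (O∞ ⊛ P∞²) n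
  ≡⟨ sym (⊛-cong-upto n (lim-upto Ok-stable (n + n) n (m≤m+n n n)) (Pk²-upto n n ≤-refl)) ⟩
    (Ok (n + n) ⊛ Pk² n) n
  ≡⟨ Ok-Pk² n n ⟩
    Pk (n + n) n
  ≡⟨ lim-upto Pk-stable (n + n) n (m≤m+n n n) n ≤-refl ⟩
    P∞ n
  ∎ where open ≡-Reasoning

-- Euler's theorem p_o = p_d: cancel P², whose constant term is 1.
euler : O∞ ≈ D∞
euler = cancel {P∞²} refl (≈trans (⊛-comm _ _) (≈trans O∞-P∞² (≈trans (≈sym D∞-P∞²) (⊛-comm _ _))))

T T′ : ℕ → ℕ
T zero = 0
T (suc j) = T j + suc j
T′ zero = 0
T′ (suc j) = T j

T≡T′+j : ∀ j → T j ≡ T′ j + j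
T≡T′+j zero = refl
T≡T′+j (suc j) = refl

T-≥ : ∀ m → m ≤ T m
T-≥ zero = z≤n
T-≥ (suc m) = subst (suc m ≤_) (+-comm (suc m) (T m)) (m≤m+n (suc m) (T m))

T′-+ : ∀ a b → T′ (a + b) ≡ T′ a + T′ b + a * b
T′-+ zero b = sym (+-identityʳ (T′ b))
T′-+ (suc a) b = begin
    T (a + b)                         ≡⟨ T≡T′+j (a + b) ⟩
    T′ (a + b) + (a + b)              ≡⟨ cong (_+ (a + b)) (T′-+ a b) ⟩
    T′ a + T′ b + a * b + (a + b)     ≡⟨ rearrange (T′ a) (T′ b) a b ⟩
    (T′ a + a) + T′ b + suc a * b     ≡⟨ cong (λ x → x + T′ b + suc a * b) (sym (T≡T′+j a)) ⟩
    T a + T′ b + suc a * b            ∎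
  where
  open ≡-Reasoning
  rearrange : ∀ x y a b → x + y + a * b + (a + b) ≡ (x + a) + y + suc a * b
  rearrange = solve-∀

T′-double : ∀ m → T′ m + T′ m + m ≡ m * m
T′-double zero = refl
T′-double (suc m) = begin
    T m + T m + suc m                    ≡⟨ cong (λ x → x + x + suc m) (T≡T′+j m) ⟩
    (T′ m + m) + (T′ m + m) + suc m      ≡⟨ rearrange (T′ m) m ⟩
    (T′ m + T′ m + m) + (m + m + 1)      ≡⟨ cong (_+ (m + m + 1)) (T′-double m) ⟩
    m * m + (m + m + 1)                  ≡⟨ square-suc m ⟩
    suc m * suc m                        ∎
  where
  open ≡-Reasoning
  rearrange : ∀ t m → (t + m) + (t + m) + suc m ≡ (t + t + m) + (m + m + 1)
  rearrange = solve-∀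
  square-suc : ∀ m → m * m + (m + m + 1) ≡ suc m * suc m
  square-suc = solve-∀

T-double : ∀ j → T j + T j ≡ j * suc j
T-double j = begin
    T j + T j                       ≡⟨ cong (λ x → x + x) (T≡T′+j j) ⟩
    (T′ j + j) + (T′ j + j)         ≡⟨ rearrange (T′ j) j ⟩
    (T′ j + T′ j + j) + j           ≡⟨ cong (_+ j) (T′-double j) ⟩
    j * j + j                       ≡⟨ trans (+-comm (j * j) j) (sym (*-suc j j)) ⟩
    j * suc j                       ∎
  where
  open ≡-Reasoning
  rearrange : ∀ t j → (t + j) + (t + j) ≡ (t + t + j) + j
  rearrange = solve-∀

prodS-X : ∀ N → prodS N X ≈ X (T′ N)
prodS-X zero = ≈refl
prodS-X (suc N) = begin
    X N ⊛ prodS N X        ≈⟨ ⊛-cong ≈refl (prodS-X N) ⟩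
    X N ⊛ X (T′ N)         ≈⟨ ≈sym (X-+ N (T′ N)) ⟩
    X (N + T′ N)           ≈⟨ X-cong (trans (+-comm N (T′ N)) (sym (T≡T′+j N))) ⟩
    X (T N)                ∎ where open ≈-Reasoning

-- The elementary symmetric functions e_k(q⁰, q¹, …, q^(N−1)).
elem : ℕ → ℕ → Series
elem zero zero = δ
elem zero (suc k) = 𝟘
elem (suc N) zero = δ
elem (suc N) (suc k) = elem N (suc k) ⊕ X N ⊛ elem N k

elem-vanish : ∀ N k → N < k → elem N k ≈ 𝟘
elem-vanish zero (suc k) _ = ≈refl
elem-vanish (suc N) (suc k) (s≤s N<k) =
  ⊕-cong (elem-vanish N (suc k) (m≤n⇒m≤1+n N<k)) (≈trans (⊛-cong ≈refl (elem-vanish N k N<k)) (⊛-zeroʳ _))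

elem-zero : ∀ N → elem N 0 ≈ δ
elem-zero zero = ≈refl
elem-zero (suc N) = ≈refl

-- Φ a N = Σ_{k ≤ N} q^(a(N−k)) e_k(q⁰, …, q^(N−1)), the expansion of Π_{i<N} (qᵃ + qⁱ).
Φ : ℕ → ℕ → Series
Φ a N = sumS (suc N) (λ k → X (a * (N ∸ k)) ⊛ elem N k)

X-Φ : ∀ a N → X a ⊛ Φ a N ≈ X (a * suc N) ⊕ sumS N (λ j → X (a * (N ∸ j)) ⊛ elem N (suc j))
X-Φ a N = begin
    X a ⊛ Φ a N
  ≈⟨ ⊛-sumS (suc N) (X a) (λ k → A k ⊛ elem N k) ⟩
    X a ⊛ (A 0 ⊛ elem N 0) ⊕ sumS N (λ j → X a ⊛ (A (suc j) ⊛ elem N (suc j)))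
  ≈⟨ ⊕-cong (≈trans (⊛-cong ≈refl (≈trans (⊛-cong ≈refl (elem-zero N)) (⊛-identityʳ _)))
                    (≈trans (≈sym (X-+ a (a * N))) (X-cong (sym (*-suc a N)))))
            (sumS-cong N (λ j j<N → ≈trans (≈sym (⊛-assoc _ _ _)) (⊛-cong (raise j j<N) ≈refl))) ⟩
    X (a * suc N) ⊕ sumS N (λ j → A j ⊛ elem N (suc j))
  ∎ where
  open ≈-Reasoning
  A : ℕ → Series
  A j = X (a * (N ∸ j))
  raise : ∀ j → j < N → X a ⊛ A (suc j) ≈ A j
  raise j j<N = ≈trans (≈sym (X-+ a _))
    (X-cong (trans (sym (*-suc a (N ∸ suc j))) (cong (a *_) (sym (N∸i≡1+N∸[1+i] N j j<N)))))

-- Choosing qᴺ or not from the new factor: the Pascal rule for e_k splits Φ a (N+1).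
Φ-suc : ∀ a N → Φ a (suc N) ≈
  (X (a * suc N) ⊕ sumS N (λ j → X (a * (N ∸ j)) ⊛ elem N (suc j))) ⊕ X N ⊛ Φ a N
Φ-suc a N = begin
    X (a * suc N) ⊛ δ ⊕ sumS (suc N) (λ j → A j ⊛ (elem N (suc j) ⊕ X N ⊛ elem N j))
  ≈⟨ ⊕-cong (⊛-identityʳ _) (≈trans (sumS-cong (suc N) (λ j _ → ⊛-distribˡ (A j) (elem N (suc j)) (X N ⊛ elem N j)))
                                    (sumS-⊕ (suc N) (λ j → A j ⊛ elem N (suc j)) (λ j → A j ⊛ (X N ⊛ elem N j)))) ⟩
    X (a * suc N) ⊕ (sumS (suc N) (λ j → A j ⊛ elem N (suc j)) ⊕ sumS (suc N) (λ j → A j ⊛ (X N ⊛ elem N j)))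
  ≈⟨ ⊕-cong {f = X (a * suc N)} ≈refl (⊕-cong (sumS-drop-last N (λ j → A j ⊛ elem N (suc j)) (≈trans (⊛-cong ≈refl (elem-vanish N (suc N) ≤-refl)) (⊛-zeroʳ (A N))))
                          (≈trans (sumS-cong (suc N) (λ j _ → swap (A j) (X N) (elem N j)))
                                  (≈sym (⊛-sumS (suc N) (X N) (λ j → A j ⊛ elem N j))))) ⟩
    X (a * suc N) ⊕ (sumS N (λ j → A j ⊛ elem N (suc j)) ⊕ X N ⊛ Φ a N)
  ≈⟨ (λ n → sym (+-assoc (X (a * suc N) n) _ _)) ⟩
    (X (a * suc N) ⊕ sumS N (λ j → A j ⊛ elem N (suc j))) ⊕ X N ⊛ Φ a N
  ∎ where
  open ≈-Reasoning
  A : ℕ → Series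
  A j = X (a * (N ∸ j))
  swap : ∀ x y z → x ⊛ (y ⊛ z) ≈ y ⊛ (x ⊛ z)
  swap = solve 3 (λ x y z → x :* (y :* z) := y :* (x :* z)) ≈refl

Φ-product : ∀ a N → Φ a N ≈ prodS N (λ i → X a ⊕ X i)
Φ-product a zero n = trans (+-identityʳ _) (trans (⊛-cong (X-cong (*-zeroʳ a)) ≈refl n) (⊛-identityˡ δ n))
Φ-product a (suc N) = begin
    Φ a (suc N)
  ≈⟨ Φ-suc a N ⟩
    (X (a * suc N) ⊕ sumS N (λ j → X (a * (N ∸ j)) ⊛ elem N (suc j))) ⊕ X N ⊛ Φ a N
  ≈⟨ ⊕-cong (≈sym (X-Φ a N)) ≈refl ⟩
    X a ⊛ Φ a N ⊕ X N ⊛ Φ a N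
  ≈⟨ ≈sym (⊛-distribʳ (X a) (X N) (Φ a N)) ⟩
    (X a ⊕ X N) ⊛ Φ a N
  ≈⟨ ⊛-cong ≈refl (Φ-product a N) ⟩
    prodS (suc N) (λ i → X a ⊕ X i)
  ∎ where open ≈-Reasoning

-- box r s counts the partitions with at most r parts, each at most s (the Gaussian
-- binomial coefficient [r+s choose r]), by whether the part s+1 is used.
box : ℕ → ℕ → Series
box r zero = δ
box zero (suc s) = δ
box (suc r) (suc s) = box (suc r) s ⊕ X (suc s) ⊛ box r (suc s)

-- e_k(q⁰, …, q^(k+s−1)) = q^T′(k) · [k+s choose k]: subtracting 0, 1, …, k−1 from the
-- chosen exponents leaves a partition into at most k parts of size at most s.
elem-box : ∀ s k → elem (k + s) k ≈ X (T′ k) ⊛ box k s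
elem-box zero zero = ≈sym (⊛-identityˡ δ)
elem-box (suc s) zero = ≈sym (⊛-identityˡ δ)
elem-box zero (suc k) = begin
    elem (k + 0) (suc k) ⊕ X (k + 0) ⊛ elem (k + 0) k
  ≈⟨ ⊕-cong (elem-vanish (k + 0) (suc k) (s≤s (≤-reflexive (+-identityʳ k)))) (⊛-cong ≈refl (elem-box zero k)) ⟩
    𝟘 ⊕ X (k + 0) ⊛ (X (T′ k) ⊛ δ)
  ≈⟨ ≈sym (⊛-assoc _ _ _) ⟩
    (X (k + 0) ⊛ X (T′ k)) ⊛ δ
  ≈⟨ ⊛-cong (≈trans (≈sym (X-+ (k + 0) (T′ k))) (X-cong exponent)) ≈refl ⟩
    X (T k) ⊛ δ
  ∎ where
  open ≈-Reasoning
  exponent : k + 0 + T′ k ≡ T k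
  exponent = trans (cong (_+ T′ k) (+-identityʳ k)) (trans (+-comm k (T′ k)) (sym (T≡T′+j k)))
elem-box (suc s) (suc k) = begin
    elem (k + suc s) (suc k) ⊕ X (k + suc s) ⊛ elem (k + suc s) k
  ≈⟨ ⊕-cong (≈trans (λ n → cong (λ x → elem x (suc k) n) (+-suc k s)) (elem-box s (suc k)))
            (⊛-cong ≈refl (elem-box (suc s) k)) ⟩
    X (T k) ⊛ box (suc k) s ⊕ X (k + suc s) ⊛ (X (T′ k) ⊛ box k (suc s))
  ≈⟨ ⊕-cong {f = X (T k) ⊛ box (suc k) s} ≈refl
            (≈trans (≈sym (⊛-assoc _ _ _)) (⊛-cong (X-interchange (k + suc s) (T′ k) (T k) (suc s) exponent) ≈refl)) ⟩
    X (T k) ⊛ box (suc k) s ⊕ (X (T k) ⊛ X (suc s)) ⊛ box k (suc s)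
  ≈⟨ solve 4 (λ a b c d → a :* b :+ (a :* c) :* d := a :* (b :+ c :* d)) ≈refl
       (X (T k)) (box (suc k) s) (X (suc s)) (box k (suc s)) ⟩
    X (T k) ⊛ (box (suc k) s ⊕ X (suc s) ⊛ box k (suc s))
  ∎ where
  open ≈-Reasoning
  exponent : k + suc s + T′ k ≡ T k + suc s
  exponent = trans (+-comm (k + suc s) (T′ k))
               (trans (sym (+-assoc (T′ k) k (suc s))) (cong (_+ suc s) (sym (T≡T′+j k))))

-- Up to degree r, at most r parts is no restriction: box r s agrees with Pk s.
box-upto : ∀ s r → box r s ≈[ r ] Pk s
box-upto zero r w _ = sym (Pk-zero w)
box-upto (suc s) zero zero _ = sym (lim-upto Pk-stable (suc s) 0 z≤n 0 z≤n)
box-upto (suc s) (suc r) w w≤ = begin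
    box (suc r) s w + (X (suc s) ⊛ box r (suc s)) w
  ≡⟨ cong₂ _+_ (box-upto s (suc r) w w≤) (sym (shift-X (suc s) (box r (suc s)) w)) ⟩
    Pk s w + shift (suc s) (box r (suc s)) w
  ≡⟨ cong (Pk s w +_) (shift-upto-suc s r (box-upto (suc s) r) w w≤) ⟩
    Pk s w + shift (suc s) (Pk (suc s)) w
  ≡⟨ sym (Pk-rec s w) ⟩
    Pk (suc s) w
  ∎ where open ≡-Reasoning

box-limit : ∀ r s w → w ≤ r → w ≤ s → box r s w ≡ P∞ w
box-limit r s w w≤r w≤s = trans (box-upto s r w w≤r) (lim-upto Pk-stable s w w≤s w ≤-refl)

-- For n ≥ 0 the product Π_{i ≤ 2n} (qⁿ + qⁱ) is computed
-- in two ways: directly it is q^(n² + T n)·2·D_n², and by Φ it is a sum of Gaussian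
-- binomials.  jtpLen n = 2n + 1 is the number of factors, jtpShift n = n² + T n the common
-- power of q.
jtpLen jtpShift : ℕ → ℕ
jtpLen n = n + suc n
jtpShift n = n * n + (n + T′ n)

Dk-product : ∀ n → Dk n ≈ prodS n (λ i → δ ⊕ X (suc i))
Dk-product zero = Dk-zero
Dk-product (suc n) = begin
    Dk (suc n)                                  ≈⟨ Dk-rec-X n ⟩
    Dk n ⊕ X (suc n) ⊛ Dk n                     ≈⟨ ⊕-cong (≈sym (⊛-identityˡ (Dk n))) ≈refl ⟩
    δ ⊛ Dk n ⊕ X (suc n) ⊛ Dk n                 ≈⟨ ≈sym (⊛-distribʳ δ (X (suc n)) (Dk n)) ⟩
    (δ ⊕ X (suc n)) ⊛ Dk n                      ≈⟨ ⊛-cong ≈refl (Dk-product n) ⟩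
    prodS (suc n) (λ i → δ ⊕ X (suc i))         ∎ where open ≈-Reasoning

-- The factors with i = n + 1 + j, j < n: qⁿ + q^(n+1+j) = qⁿ(1 + q^(j+1)).
upper-factors : ∀ n → prodS n (λ i → X n ⊕ X (n + suc i)) ≈ X (n * n) ⊛ Dk n
upper-factors n = begin
    prodS n (λ i → X n ⊕ X (n + suc i))
  ≈⟨ prodS-cong n (λ i _ → ≈trans (⊕-cong (≈sym (⊛-identityʳ (X n))) (X-+ n (suc i)))
                                  (≈sym (⊛-distribˡ (X n) δ (X (suc i))))) ⟩
    prodS n (λ i → X n ⊛ (δ ⊕ X (suc i)))
  ≈⟨ prodS-⊛ n (λ _ → X n) (λ i → δ ⊕ X (suc i)) ⟩
    prodS n (λ _ → X n) ⊛ prodS n (λ i → δ ⊕ X (suc i))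
  ≈⟨ ⊛-cong (prodS-const n n) (≈sym (Dk-product n)) ⟩
    X (n * n) ⊛ Dk n
  ∎ where open ≈-Reasoning

-- The factors with i < n: qⁿ + qⁱ = qⁱ(1 + q^(n−i)).
lower-factors : ∀ n → prodS n (λ i → X n ⊕ X i) ≈ X (T′ n) ⊛ Dk n
lower-factors n = begin
    prodS n (λ i → X n ⊕ X i)
  ≈⟨ prodS-cong n (λ i i<n → ≈trans (⊕-cong (≈trans (X-cong (sym (m+[n∸m]≡n (<⇒≤ i<n)))) (X-+ i (n ∸ i)))
                                             (≈sym (⊛-identityʳ (X i))))
                                    (solve 3 (λ a b c → a :* b :+ a :* c := a :* (c :+ b)) ≈refl (X i) (X (n ∸ i)) δ)) ⟩
    prodS n (λ i → X i ⊛ (δ ⊕ X (n ∸ i)))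
  ≈⟨ prodS-⊛ n X (λ i → δ ⊕ X (n ∸ i)) ⟩
    prodS n X ⊛ prodS n (λ i → δ ⊕ X (n ∸ i))
  ≈⟨ ⊛-cong (prodS-X n) (prodS-cong n (λ i i<n → ⊕-cong {f = δ} ≈refl (X-cong (N∸i≡1+N∸[1+i] n i i<n)))) ⟩
    X (T′ n) ⊛ prodS n (λ i → δ ⊕ X (suc (n ∸ suc i)))
  ≈⟨ ⊛-cong ≈refl (≈trans (prodS-reverse n (λ j → δ ⊕ X (suc j))) (≈sym (Dk-product n))) ⟩
    X (T′ n) ⊛ Dk n
  ∎ where open ≈-Reasoning

-- Π_{i ≤ 2n} (qⁿ + qⁱ) = q^jtpShift(n) · (D_n² + D_n²); the factor i = n is 2qⁿ.
jtp-product : ∀ n → prodS (jtpLen n) (λ i → X n ⊕ X i) ≈ X (jtpShift n) ⊛ (Dk n ⊛ Dk n ⊕ Dk n ⊛ Dk n)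
jtp-product n = begin
    prodS (n + suc n) F
  ≈⟨ ≈trans (prodS-split n (suc n) F) (⊛-cong (prodS-split 1 n (λ i → F (n + i))) ≈refl) ⟩
    (prodS n (λ i → F (n + suc i)) ⊛ (F (n + 0) ⊛ δ)) ⊛ prodS n F
  ≈⟨ ⊛-cong (⊛-cong (upper-factors n) (≈trans (⊛-identityʳ _) (⊕-cong {f = X n} ≈refl (X-cong (+-identityʳ n)))))
            (lower-factors n) ⟩
    (X (n * n) ⊛ Dk n ⊛ (X n ⊕ X n)) ⊛ (X (T′ n) ⊛ Dk n)
  ≈⟨ solve 4 (λ a b c d → (a :* d :* (b :+ b)) :* (c :* d) := ((a :* b) :* c) :* (d :* d :+ d :* d))
       ≈refl (X (n * n)) (X n) (X (T′ n)) (Dk n) ⟩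
    ((X (n * n) ⊛ X n) ⊛ X (T′ n)) ⊛ (Dk n ⊛ Dk n ⊕ Dk n ⊛ Dk n)
  ≈⟨ ⊛-cong (≈trans (⊛-assoc _ _ _) (≈trans (⊛-cong ≈refl (≈sym (X-+ n (T′ n)))) (≈sym (X-+ (n * n) (n + T′ n))))) ≈refl ⟩
    X (jtpShift n) ⊛ (Dk n ⊛ Dk n ⊕ Dk n ⊛ Dk n)
  ∎ where
  open ≈-Reasoning
  F : ℕ → Series
  F i = X n ⊕ X i

-- By elem-box the k-th term of Φ n (2n+1) has exponent n(2n+1−k) + T′ k, which is
-- jtpShift n plus a triangular number: for k ≤ n, writing n = k + m, it is T m ...
exponent-low : ∀ k m → (k + m) * (m + suc (k + m)) + T′ k ≡ jtpShift (k + m) + T m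
exponent-low k m = begin
    (k + m) * (m + suc (k + m)) + T′ k
  ≡⟨ expand k m (T′ k) ⟩
    (k + m) * (k + m) + ((k + m) + T′ k + k * m + m * m)
  ≡⟨ cong (λ x → (k + m) * (k + m) + ((k + m) + T′ k + k * m + x)) (sym (T′-double m)) ⟩
    (k + m) * (k + m) + ((k + m) + T′ k + k * m + (T′ m + T′ m + m))
  ≡⟨ regroup k m (T′ k) (T′ m) ⟩
    (k + m) * (k + m) + ((k + m) + (T′ k + T′ m + k * m)) + (T′ m + m)
  ≡⟨ cong₂ (λ x y → (k + m) * (k + m) + ((k + m) + x) + y) (sym (T′-+ k m)) (sym (T≡T′+j m)) ⟩
    jtpShift (k + m) + T m
  ∎ where
  open ≡-Reasoning
  expand : ∀ k m t → (k + m) * (m + suc (k + m)) + t ≡ (k + m) * (k + m) + ((k + m) + t + k * m + m * m)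
  expand = solve-∀
  regroup : ∀ k m t u → (k + m) * (k + m) + ((k + m) + t + k * m + (u + u + m)) ≡
                        (k + m) * (k + m) + ((k + m) + (t + u + k * m)) + (u + m)
  regroup = solve-∀

-- ... and for k = n + 1 + j with j ≤ n, writing n = j + r, it is T j.
exponent-high : ∀ j r → (j + r) * r + T ((j + r) + j) ≡ jtpShift (j + r) + T j
exponent-high j r = begin
    (j + r) * r + T ((j + r) + j)
  ≡⟨ cong ((j + r) * r +_) (T≡T′+j ((j + r) + j)) ⟩
    (j + r) * r + (T′ ((j + r) + j) + ((j + r) + j))
  ≡⟨ cong (λ x → (j + r) * r + (x + ((j + r) + j))) (trans (T′-+ (j + r) j) (cong (λ y → y + T′ j + (j + r) * j) (T′-+ j r))) ⟩
    (j + r) * r + (T′ j + T′ r + j * r + T′ j + (j + r) * j + ((j + r) + j))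
  ≡⟨ regroup j r (T′ j) (T′ r) ⟩
    (j + r) * (j + r) + ((j + r) + (T′ j + T′ r + j * r)) + (T′ j + j)
  ≡⟨ cong₂ (λ x y → (j + r) * (j + r) + ((j + r) + x) + y) (sym (T′-+ j r)) (sym (T≡T′+j j)) ⟩
    jtpShift (j + r) + T j
  ∎ where
  open ≡-Reasoning
  regroup : ∀ j r u v → (j + r) * r + (u + v + j * r + u + (j + r) * j + ((j + r) + j)) ≡
                        (j + r) * (j + r) + ((j + r) + (u + v + j * r)) + (u + j)
  regroup = solve-∀

Φ-term : ℕ → ℕ → Series
Φ-term n k = X (n * (jtpLen n ∸ k)) ⊛ elem (jtpLen n) k

Φ-term-low : ∀ n k → k ≤ n → Φ-term n k ≈ X (jtpShift n) ⊛ (X (T (n ∸ k)) ⊛ box k (jtpLen n ∸ k))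
Φ-term-low n k k≤n = subst (λ n → Φ-term n k ≈ X (jtpShift n) ⊛ (X (T (n ∸ k)) ⊛ box k (jtpLen n ∸ k)))
                           (m+[n∸m]≡n k≤n) (at-split (n ∸ k))
  where
  at-split : ∀ m → Φ-term (k + m) k ≈ X (jtpShift (k + m)) ⊛ (X (T ((k + m) ∸ k)) ⊛ box k (jtpLen (k + m) ∸ k))
  at-split m = begin
      X (n′ * (jtpLen n′ ∸ k)) ⊛ elem (jtpLen n′) k
    ≈⟨ ⊛-cong (X-cong (cong (n′ *_) width≡)) (λ i → cong (λ x → elem x k i) jtpLen≡) ⟩
      X (n′ * s) ⊛ elem (k + s) k
    ≈⟨ ⊛-cong ≈refl (elem-box s k) ⟩
      X (n′ * s) ⊛ (X (T′ k) ⊛ box k s)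
    ≈⟨ ≈trans (≈sym (⊛-assoc _ _ _)) (⊛-cong (X-interchange (n′ * s) (T′ k) (jtpShift n′) (T m) (exponent-low k m)) ≈refl) ⟩
      (X (jtpShift n′) ⊛ X (T m)) ⊛ box k s
    ≈⟨ ≈trans (⊛-assoc _ _ _) (⊛-cong ≈refl (⊛-cong (X-cong (cong T (sym (m+n∸m≡n k m)))) (λ i → cong (λ x → box k x i) (sym width≡)))) ⟩
      X (jtpShift n′) ⊛ (X (T (n′ ∸ k)) ⊛ box k (jtpLen n′ ∸ k))
    ∎ where
    open ≈-Reasoning
    n′ s : ℕ
    n′ = k + m
    s = m + suc (k + m)
    jtpLen≡ : jtpLen n′ ≡ k + s
    jtpLen≡ = +-assoc k m (suc (k + m))
    width≡ : jtpLen n′ ∸ k ≡ s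
    width≡ = trans (cong (_∸ k) jtpLen≡) (m+n∸m≡n k s)

Φ-term-high : ∀ n j → j ≤ n → Φ-term n (suc n + j) ≈ X (jtpShift n) ⊛ (X (T j) ⊛ box (suc n + j) (n ∸ j))
Φ-term-high n j j≤n = subst (λ n → Φ-term n (suc n + j) ≈ X (jtpShift n) ⊛ (X (T j) ⊛ box (suc n + j) (n ∸ j)))
                            (m+[n∸m]≡n j≤n) (at-split (n ∸ j))
  where
  at-split : ∀ r → Φ-term (j + r) (suc (j + r) + j) ≈ X (jtpShift (j + r)) ⊛ (X (T j) ⊛ box (suc (j + r) + j) ((j + r) ∸ j))
  at-split r = begin
      X (n′ * (jtpLen n′ ∸ k)) ⊛ elem (jtpLen n′) k
    ≈⟨ ⊛-cong (X-cong (cong (n′ *_) width≡)) (λ i → cong (λ x → elem x k i) jtpLen≡) ⟩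
      X (n′ * r) ⊛ elem (k + r) k
    ≈⟨ ⊛-cong ≈refl (elem-box r k) ⟩
      X (n′ * r) ⊛ (X (T (n′ + j)) ⊛ box k r)
    ≈⟨ ≈trans (≈sym (⊛-assoc _ _ _)) (⊛-cong (X-interchange (n′ * r) (T (n′ + j)) (jtpShift n′) (T j) (exponent-high j r)) ≈refl) ⟩
      (X (jtpShift n′) ⊛ X (T j)) ⊛ box k r
    ≈⟨ ≈trans (⊛-assoc _ _ _) (⊛-cong ≈refl (⊛-cong ≈refl (λ i → cong (λ x → box k x i) (sym (m+n∸m≡n j r))))) ⟩
      X (jtpShift n′) ⊛ (X (T j) ⊛ box k (n′ ∸ j))
    ∎ where
    open ≈-Reasoning
    n′ k : ℕ
    n′ = j + r
    k = suc n′ + j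
    jtpLen≡ : jtpLen n′ ≡ k + r
    jtpLen≡ = reorder j r
      where reorder : ∀ j r → (j + r) + suc (j + r) ≡ (suc (j + r) + j) + r
            reorder = solve-∀
    width≡ : jtpLen n′ ∸ k ≡ r
    width≡ = trans (cong (_∸ k) jtpLen≡) (m+n∸m≡n k r)

jtpLow jtpHigh : ℕ → Series
jtpLow n = sumS (suc n) (λ k → X (T (n ∸ k)) ⊛ box k (jtpLen n ∸ k))
jtpHigh n = sumS (suc n) (λ j → X (T j) ⊛ box (suc n + j) (n ∸ j))

finite-jtp : ∀ n → jtpLow n ⊕ jtpHigh n ≈ Dk n ⊛ Dk n ⊕ Dk n ⊛ Dk n
finite-jtp n = X-cancel (jtpShift n) (begin
    X c ⊛ (jtpLow n ⊕ jtpHigh n)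
  ≈⟨ ≈trans (⊛-distribˡ (X c) (jtpLow n) (jtpHigh n))
            (⊕-cong (⊛-sumS (suc n) (X c) (λ k → X (T (n ∸ k)) ⊛ box k (jtpLen n ∸ k)))
                    (⊛-sumS (suc n) (X c) (λ j → X (T j) ⊛ box (suc n + j) (n ∸ j)))) ⟩
    sumS (suc n) (λ k → X c ⊛ (X (T (n ∸ k)) ⊛ box k (jtpLen n ∸ k)))
      ⊕ sumS (suc n) (λ j → X c ⊛ (X (T j) ⊛ box (suc n + j) (n ∸ j)))
  ≈⟨ ⊕-cong (sumS-cong (suc n) (λ k k≤n → ≈sym (Φ-term-low n k (≤-pred k≤n))))
            (sumS-cong (suc n) (λ j j≤n → ≈sym (Φ-term-high n j (≤-pred j≤n)))) ⟩
    sumS (suc n) (Φ-term n) ⊕ sumS (suc n) (λ j → Φ-term n (suc n + j))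
  ≈⟨ ≈sym (sumS-split (suc n) (suc n) (Φ-term n)) ⟩
    Φ n (jtpLen n)
  ≈⟨ Φ-product n (jtpLen n) ⟩
    prodS (jtpLen n) (λ i → X n ⊕ X i)
  ≈⟨ jtp-product n ⟩
    X c ⊛ (Dk n ⊛ Dk n ⊕ Dk n ⊛ Dk n)
  ∎) where
  open ≈-Reasoning
  c : ℕ
  c = jtpShift n

-- ψ = Σ_j q^T(j).  Its product with F has w-th coefficient Ψ F w = Σ_{m ≤ w} (q^T(m)·F)_w;
-- terms with m > w vanish since T m ≥ m.
ψ : Series
ψ w = sumN (suc w) (λ m → X (T m) w)

Ψ : Series → Series
Ψ F w = sumN (suc w) (λ m → shift (T m) F w)

Ψ-extend : ∀ F w L → w ≤ L → sumN (suc L) (λ m → shift (T m) F w) ≡ Ψ F w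
Ψ-extend F w L w≤L = sumN-extend (suc w) (suc L) _ (s≤s w≤L) (λ m w<m _ → shift-< (T m) F w (≤-trans w<m (T-≥ m)))

ψ-⊛ : ∀ F → ψ ⊛ F ≈ Ψ F
ψ-⊛ F w = begin
    (ψ ⊛ F) w
  ≡⟨ ⊛-cong-upto w (λ i i≤w → sym (Ψ-extend δ i w i≤w)) (λ _ _ → refl) ⟩
    (sumS (suc w) (λ m → X (T m)) ⊛ F) w
  ≡⟨ sumS-⊛ (suc w) (λ m → X (T m)) F w ⟩
    sumN (suc w) (λ m → (X (T m) ⊛ F) w)
  ≡⟨ sumN-cong (suc w) (λ m _ → sym (shift-X (T m) F w)) ⟩
    Ψ F w
  ∎ where open ≡-Reasoning

-- At n = 2w, every Gaussian binomial in jtpLow and jtpHigh is wide and tall enough to agree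
-- with P at degree w, so both halves tend to ψ·P.
jtpLow-limit : ∀ w → jtpLow (w + w) w ≡ Ψ P∞ w
jtpLow-limit w = begin
    sumN (suc n) (λ k → (X (T (n ∸ k)) ⊛ box k (jtpLen n ∸ k)) w)
  ≡⟨ sumN-cong (suc n) (λ k k≤n → trans (sym (shift-X (T (n ∸ k)) (box k (jtpLen n ∸ k)) w))
       (shift-agree (T (n ∸ k)) (box k (jtpLen n ∸ k)) P∞ w
          (λ T≤w → box-limit k (jtpLen n ∸ k) (w ∸ T (n ∸ k)) (tall k (≤-pred k≤n) T≤w) (wide k (≤-pred k≤n))))) ⟩
    sumN (suc n) (λ k → shift (T (n ∸ k)) P∞ w)
  ≡⟨ sumN-reverse (suc n) (λ m → shift (T m) P∞ w) ⟩
    sumN (suc n) (λ m → shift (T m) P∞ w)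
  ≡⟨ Ψ-extend P∞ w n (m≤m+n w w) ⟩
    Ψ P∞ w
  ∎ where
  open ≡-Reasoning
  n : ℕ
  n = w + w
  -- A term contributes only if T (n − k) ≤ w, which forces k ≥ w.
  tall : ∀ k → k ≤ n → T (n ∸ k) ≤ w → w ∸ T (n ∸ k) ≤ k
  tall k k≤n T≤w = ≤-trans (m∸n≤m w (T (n ∸ k))) w≤k
    where w≤k : w ≤ k
          w≤k = +-cancelˡ-≤ w w k (≤-trans (≤-reflexive (sym (m∸n+n≡m k≤n)))
                   (+-monoˡ-≤ k (≤-trans (T-≥ (n ∸ k)) T≤w)))
  wide : ∀ k → k ≤ n → w ∸ T (n ∸ k) ≤ jtpLen n ∸ k
  wide k k≤n = ≤-trans (m∸n≤m w (T (n ∸ k)))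
                 (≤-trans (≤-trans (m≤m+n w w) (n≤1+n n))
                   (≤-trans (≤-reflexive (sym (m+n∸m≡n n (suc n)))) (∸-monoʳ-≤ (jtpLen n) k≤n)))

jtpHigh-limit : ∀ w → jtpHigh (w + w) w ≡ Ψ P∞ w
jtpHigh-limit w = begin
    sumN (suc n) (λ j → (X (T j) ⊛ box (suc n + j) (n ∸ j)) w)
  ≡⟨ sumN-cong (suc n) (λ j _ → trans (sym (shift-X (T j) (box (suc n + j) (n ∸ j)) w))
       (shift-agree (T j) (box (suc n + j) (n ∸ j)) P∞ w
          (λ T≤w → box-limit (suc n + j) (n ∸ j) (w ∸ T j) (tall j) (wide j (≤-trans (T-≥ j) T≤w))))) ⟩
    sumN (suc n) (λ m → shift (T m) P∞ w)
  ≡⟨ Ψ-extend P∞ w n (m≤m+n w w) ⟩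
    Ψ P∞ w
  ∎ where
  open ≡-Reasoning
  n : ℕ
  n = w + w
  tall : ∀ j → w ∸ T j ≤ suc n + j
  tall j = ≤-trans (m∸n≤m w (T j)) (≤-trans (m≤m+n w w) (≤-trans (n≤1+n n) (m≤m+n (suc n) j)))
  wide : ∀ j → j ≤ w → w ∸ T j ≤ n ∸ j
  wide j j≤w = ≤-trans (m∸n≤m w (T j)) (≤-trans (≤-reflexive (sym (m+n∸n≡m w j))) (∸-monoˡ-≤ j (+-monoʳ-≤ w j≤w)))

-- The Jacobi triple product consequence ψ·P = D², i.e. ψ(q) = (q²;q²)∞ / (q;q²)∞.
ψ-P∞ : ψ ⊛ P∞ ≈ D∞ ⊛ D∞
ψ-P∞ w = trans (ψ-⊛ P∞ w) (double-injective _ _ (begin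
    Ψ P∞ w + Ψ P∞ w
  ≡⟨ sym (cong₂ _+_ (jtpLow-limit w) (jtpHigh-limit w)) ⟩
    jtpLow (w + w) w + jtpHigh (w + w) w
  ≡⟨ finite-jtp (w + w) w ⟩
    (Dk (w + w) ⊛ Dk (w + w)) w + (Dk (w + w) ⊛ Dk (w + w)) w
  ≡⟨ cong₂ _+_ D-limit D-limit ⟩
    (D∞ ⊛ D∞) w + (D∞ ⊛ D∞) w
  ∎))
  where
  open ≡-Reasoning
  D-limit : (Dk (w + w) ⊛ Dk (w + w)) w ≡ (D∞ ⊛ D∞) w
  D-limit = ⊛-cong-upto w (lim-upto Dk-stable (w + w) w (m≤m+n w w)) (lim-upto Dk-stable (w + w) w (m≤m+n w w))

ψ-P∞² : ψ ⊛ P∞² ≈ D∞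
ψ-P∞² = cancel {D∞} refl (begin
    D∞ ⊛ (ψ ⊛ P∞²)
  ≈⟨ solve 3 (λ d s e → d :* (s :* e) := s :* (d :* e)) ≈refl D∞ ψ P∞² ⟩
    ψ ⊛ (D∞ ⊛ P∞²)
  ≈⟨ ⊛-cong ≈refl D∞-P∞² ⟩
    ψ ⊛ P∞
  ≈⟨ ψ-P∞ ⟩
    D∞ ⊛ D∞
  ∎) where open ≈-Reasoning

p≡P∞ : ∀ n → p n ≡ P∞ n
p≡P∞ n = sym (length-filter-true (partitions n))

tri≡T : ∀ j → tri j ≡ T j
tri≡T j = trans (cong (_/ 2) (sym (T-double j))) (half-double (T j))

dilate-value : ∀ f x → dilate f x ≡ (if not (par x) then f (x / 2) else 0)
dilate-value f x with even-or-odd x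
... | inj₁ (y , refl) rewrite par-double y | half-double y = dilate-double f y
... | inj₂ (y , refl) rewrite par-double+1 y = dilate-double+1 f y

sameBool-xor : ∀ a c → sameBool a (a xor c) ≡ not c
sameBool-xor true true = refl
sameBool-xor true false = refl
sameBool-xor false true = refl
sameBool-xor false false = refl

-- The j-th summand of triSum (isOdd n) n is the coefficient of qⁿ in q^T(j)·P(q²): the
-- parity test in triSum is exactly the evenness of n − T j.
triSum-term : ∀ n j →
  (if (tri j ≤ᵇ n) ∧ sameBool (isOdd (tri j)) (isOdd n) then p ((n ∸ tri j) / 2) else 0) ≡ shift (T j) P∞² n
triSum-term n j rewrite tri≡T j | shift-value (T j) P∞² n with T j ≤? n
... | no T≰n rewrite ≤ᵇ-false T≰n = refl
... | yes T≤n rewrite ≤ᵇ-true T≤n = begin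
    (if sameBool (isOdd (T j)) (isOdd n) then p (x / 2) else 0)
  ≡⟨ cong₂ (λ b v → if b then v else 0) same-parity (p≡P∞ (x / 2)) ⟩
    (if not (par x) then P∞ (x / 2) else 0)
  ≡⟨ sym (dilate-value P∞ x) ⟩
    dilate P∞ x
  ∎ where
  open ≡-Reasoning
  x : ℕ
  x = n ∸ T j
  same-parity : sameBool (isOdd (T j)) (isOdd n) ≡ not (par x)
  same-parity = begin
      sameBool (isOdd (T j)) (isOdd n)
    ≡⟨ cong₂ sameBool (isOdd-par (T j)) (trans (isOdd-par n) (cong par (sym (m+[n∸m]≡n T≤n)))) ⟩
      sameBool (par (T j)) (par (T j + x))
    ≡⟨ cong (sameBool (par (T j))) (par-+ (T j) x) ⟩
      sameBool (par (T j)) (par (T j) xor par x)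
    ≡⟨ sameBool-xor (par (T j)) (par x) ⟩
      not (par x)
    ∎

triSum-coefficient : ∀ n → triSum (isOdd n) n ≡ D∞ n
triSum-coefficient n = begin
    triSum (isOdd n) n
  ≡⟨ sum-map-applyUpTo _ (λ m → m) (suc n) ⟩
    sumN (suc n) (λ j → if (tri j ≤ᵇ n) ∧ sameBool (isOdd (tri j)) (isOdd n) then p ((n ∸ tri j) / 2) else 0)
  ≡⟨ sumN-cong (suc n) (λ j _ → triSum-term n j) ⟩
    Ψ P∞² n
  ≡⟨ sym (ψ-⊛ P∞² n) ⟩
    (ψ ⊛ P∞²) n
  ≡⟨ ψ-P∞² n ⟩
    D∞ n
  ∎ where open ≡-Reasoning

theorem3p1 : ((n : ℕ) → 1 ≤ n → 2 ∣ n → triSum false n ≡ pd n)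
    × ((n : ℕ) → 1 ≤ n → ¬ (2 ∣ n) → triSum true n ≡ po n)
theorem3p1 = even , odd
  where
  even : (n : ℕ) → 1 ≤ n → 2 ∣ n → triSum false n ≡ pd n
  even n _ 2∣n = subst (λ b → triSum b n ≡ pd n) (trans (isOdd-par n) (par-of-even 2∣n)) (triSum-coefficient n)
  odd : (n : ℕ) → 1 ≤ n → ¬ (2 ∣ n) → triSum true n ≡ po n
  odd n _ 2∤n = subst (λ b → triSum b n ≡ po n) (trans (isOdd-par n) (par-of-odd 2∤n))
                      (trans (triSum-coefficient n) (sym (euler n)))
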